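{- Let $G$ be an irreflexive oriented graph. The following are equivalent. (1) $G$ has an iot-injective homomorphism to $T_2^r$. (2) No $F\in\mathcal{S}\cup\mathcal{P}$ has an iot-injective homomorphism to $G$. (3) Each component $D$ of $G$ satisfies one of: (a) $D$ is an oriented path on at most four vertices; (b) $D$ is an oriented path with an alternating matching; (c) $D$ is an oriented cycle on $4k$ vertices, for some $k\ge1$, with an alternating matching.
   Context: $T_2^r$ has vertices $t_0,t_1$, a loop at each, and the arc $t_0t_1$. A homomorphism $f$ is iot-injective if for every vertex $x$ of the domain, $f$ restricted to $N^-(x)\cup N^+(x)$ (all in- and out-neighbours together) is injective. $\mathcal{S}$ is the set of all orientations of $K_{1,3}$. An alternating matching in an oriented path or oriented cycle is a matching that saturates every vertex of degree two in the underlying graph and whose edges alternate in orientation (forwards/backwards) with respect to the vertex ordering of the path or cycle. $\mathcal{P}$ is the set of oriented paths $P$ with vertices $v_0,v_1,\dots,v_{2k}$ in order, $k\ge2$, such that: the subpath on $v_1,\dots,v_{2k-1}$ is the union of two disjoint alternating matchings (its odd-position arcs form an alternating matching and so do its even-position arcs); the arc between $v_0,v_1$ has the same orientation with respect to the path ordering as the arc between $v_2,v_3$; and the arc between $v_{2k-1},v_{2k}$ has the same orientation as the arc between $v_{2k-3},v_{2k-2}$. -}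

module Defs where

open import Data.Nat using (ℕ; zero; suc; _+_; _*_; _∸_; _≤_; _<_)
open import Data.Bool using (Bool; true; false; not; _∨_; T)
open import Data.Fin using (Fin; toℕ)
open import Data.List using (List; []; _∷_; length; lookup; take; drop)
open import Data.Product using (Σ; ∃; ∃-syntax; _×_; _,_)
open import Data.Sum using (_⊎_)
open import Data.Empty using (⊥)
open import Relation.Nullary using (¬_)
open import Relation.Binary.PropositionalEquality using (_≡_; _≢_)
open import Function.Definitions using (Injective)

record Digraph : Set where
  field
    size : ℕ
    arc  : Fin size → Fin size → Bool

open Digraph public

Arc : (G : Digraph) → Fin (size G) → Fin (size G) → Set
Arc G x y = T (arc G x y)

Nbr : (G : Digraph) → Fin (size G) → Fin (size G) → Set
Nbr G x y = Arc G x y ⊎ Arc G y x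

IrreflexiveOriented : Digraph → Set
IrreflexiveOriented G =
  (∀ x → arc G x x ≡ false) × (∀ x y → Arc G x y → Arc G y x → ⊥)

IsHom : (F G : Digraph) → (Fin (size F) → Fin (size G)) → Set
IsHom F G f = ∀ x y → Arc F x y → Arc G (f x) (f y)

IotInjective : (F G : Digraph) → (Fin (size F) → Fin (size G)) → Set
IotInjective F G f = ∀ x y z → Nbr F x y → Nbr F x z → f y ≡ f z → y ≡ z

IotHom : Digraph → Digraph → Set
IotHom F G = Σ (Fin (size F) → Fin (size G)) λ f → IsHom F G f × IotInjective F G f

-- T_2^r : vertices t0 = 0, t1 = 1, loops at both, arc t0 → t1.

T2r : Digraph
T2r = record { size = 2 ; arc = a }
  where
  a : Fin 2 → Fin 2 → Bool
  a Fin.zero Fin.zero = true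
  a Fin.zero (Fin.suc Fin.zero) = true
  a (Fin.suc Fin.zero) (Fin.suc Fin.zero) = true
  a (Fin.suc Fin.zero) Fin.zero = false

-- Oriented paths and cycles given by a direction list.
-- A list ds = d_0 … d_{m-1}; edge e joins vertices e and e+1, and is
-- oriented forwards (e → e+1) iff d_e = true.

pArc : List Bool → ℕ → ℕ → Bool
pArc [] a b = false
pArc (d ∷ ds) zero (suc zero) = d
pArc (d ∷ ds) (suc zero) zero = not d
pArc (d ∷ ds) (suc a) (suc b) = pArc ds a b
pArc (d ∷ ds) _ _ = false

pathG : List Bool → Digraph
pathG ds = record { size = suc (length ds) ; arc = λ i j → pArc ds (toℕ i) (toℕ j) }

-- oriented cycle on length ds vertices (meaningful when length ds ≥ 3);
-- edge e joins e and (e+1 mod m); vertex m is identified with 0.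
wrap : List Bool → ℕ → ℕ
wrap ds zero = length ds
wrap ds (suc a) = suc a

cArc : List Bool → ℕ → ℕ → Bool
cArc ds a b = pArc ds a b ∨ pArc ds (wrap ds a) b ∨ pArc ds a (wrap ds b)

cycleG : List Bool → Digraph
cycleG ds = record { size = length ds ; arc = λ i j → cArc ds (toℕ i) (toℕ j) }

-- orientations of K_{1,3}: centre 0, leaves 1,2,3; bᵢ = true means 0 → i.
starArc : Bool → Bool → Bool → Fin 4 → Fin 4 → Bool
starArc b1 b2 b3 Fin.zero (Fin.suc Fin.zero) = b1
starArc b1 b2 b3 Fin.zero (Fin.suc (Fin.suc Fin.zero)) = b2
starArc b1 b2 b3 Fin.zero (Fin.suc (Fin.suc (Fin.suc Fin.zero))) = b3
starArc b1 b2 b3 (Fin.suc Fin.zero) Fin.zero = not b1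
starArc b1 b2 b3 (Fin.suc (Fin.suc Fin.zero)) Fin.zero = not b2
starArc b1 b2 b3 (Fin.suc (Fin.suc (Fin.suc Fin.zero))) Fin.zero = not b3
starArc b1 b2 b3 _ _ = false

starG : Bool → Bool → Bool → Digraph
starG b1 b2 b3 = record { size = 4 ; arc = starArc b1 b2 b3 }

AltMatchingPath : (ds : List Bool) → (Fin (length ds) → Bool) → Set
AltMatchingPath ds M =
  -- matching: no two (consecutive) edges sharing a vertex
  (∀ e f → M e ≡ true → M f ≡ true → toℕ f ≡ suc (toℕ e) → ⊥)
  -- saturates every degree-two vertex v (1 ≤ v ≤ m-1)
  × (∀ v → 1 ≤ v → v < length ds →
       ∃[ e ] (M e ≡ true × (toℕ e ≡ v ⊎ suc (toℕ e) ≡ v)))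
  × (∀ e f → M e ≡ true → M f ≡ true → toℕ e < toℕ f →
       (∀ g → toℕ e < toℕ g → toℕ g < toℕ f → M g ≡ false) →
       lookup ds e ≢ lookup ds f)

-- strictly between e and f going cyclically forward from e
CycBetween : ℕ → ℕ → ℕ → Set
CycBetween e f g = (e < f × e < g × g < f) ⊎ (f < e × (e < g ⊎ g < f))

AltMatchingCycle : (ds : List Bool) → (Fin (length ds) → Bool) → Set
AltMatchingCycle ds M =
  (∀ e f → M e ≡ true → M f ≡ true →
     (toℕ f ≡ suc (toℕ e) ⊎ (suc (toℕ e) ≡ length ds × toℕ f ≡ 0)) → ⊥)
  -- saturates every vertex (all have degree two)
  × (∀ (v : Fin (length ds)) →
       ∃[ e ] (M e ≡ true ×
                (toℕ e ≡ toℕ v ⊎ suc (toℕ e) ≡ toℕ v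
                  ⊎ (suc (toℕ e) ≡ length ds × toℕ v ≡ 0))))
  × (∀ e f → M e ≡ true → M f ≡ true → e ≢ f →
       (∀ g → CycBetween (toℕ e) (toℕ f) (toℕ g) → M g ≡ false) →
       lookup ds e ≢ lookup ds f)

-- The family 𝒫 (direction lists of the paths v_0 … v_{2k}).

isEven : ℕ → Bool
isEven zero = true
isEven (suc n) = not (isEven n)

-- d_i with a default (only used for in-range indices)
at : List Bool → ℕ → Bool
at [] i = false
at (d ∷ ds) zero = d
at (d ∷ ds) (suc i) = at ds i

InP : List Bool → Set
InP ds = ∃[ k ] (2 ≤ k × length ds ≡ 2 * k ×
  -- subpath v_1 … v_{2k-1} (arcs 1 … 2k-2): odd- and even-position arcs
  -- each form an alternating matching of it
  AltMatchingPath (take (2 * k ∸ 2) (drop 1 ds)) (λ e → isEven (toℕ e)) ×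
  AltMatchingPath (take (2 * k ∸ 2) (drop 1 ds)) (λ e → not (isEven (toℕ e))) ×
  at ds 0 ≡ at ds 2 ×
  at ds (2 * k ∸ 1) ≡ at ds (2 * k ∸ 3))

data Conn (G : Digraph) (x : Fin (size G)) : Fin (size G) → Set where
  here : Conn G x x
  step : ∀ {y z} → Conn G x y → Nbr G y z → Conn G x z

ComponentIs : (G : Digraph) → Fin (size G) → Digraph → Set
ComponentIs G v H = Σ (Fin (size H) → Fin (size G)) λ φ →
  Injective _≡_ _≡_ φ ×
  (∀ i j → arc H i j ≡ arc G (φ i) (φ j)) ×
  (∀ i → Conn G v (φ i)) ×
  (∀ y → Conn G v y → ∃[ i ] (φ i ≡ y))

Cond1 : Digraph → Set
Cond1 G = IotHom G T2r

Cond2 : Digraph → Set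
Cond2 G = (∀ b1 b2 b3 → ¬ IotHom (starG b1 b2 b3) G)
        × (∀ ds → InP ds → ¬ IotHom (pathG ds) G)

Cond3 : Digraph → Set
Cond3 G = ∀ v →
    (∃[ ds ] (length ds ≤ 3 × ComponentIs G v (pathG ds)))
  ⊎ (∃[ ds ] ((∃[ M ] AltMatchingPath ds M) × ComponentIs G v (pathG ds)))
  ⊎ (∃[ k ] ∃[ ds ] (1 ≤ k × length ds ≡ 4 * k ×
        (∃[ M ] AltMatchingCycle ds M) × ComponentIs G v (cycleG ds)))

-- An iot-homomorphism from an oriented path to T₂ʳ labels the vertices by t₀ and t₁ so that the two neighbours
-- of every inner vertex get different labels; hence the label changes across every other arc, and where it
-- changes the arc points from t₀ to t₁.  So a labelling exists exactly when the arcs of one parity class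
-- alternate in direction, i.e. form an alternating matching.  The paths of 𝒫 violate this for both parities
-- (at their first and at their last arcs), stars have three neighbours for two labels, and iot-homomorphisms
-- compose: (1) ⇒ (2).  On a cycle of length 4k the labelling closes up, and the labellings of the components
-- glue: (3) ⇒ (1); and (3) ⇒ (2) because stars and paths are connected.  Conversely, without stars every
-- vertex has degree at most two, so a greedy non-backtracking walk enumerates each component as a path or a
-- cycle.  If along the walk neither parity class alternated, the arcs between two closest repetitions of
-- opposite parity would form a path of 𝒫; so one class alternates, giving the alternating matching, and on a
-- cycle of length t going around once and twice forces t ≡ 0 mod 4: (2) ⇒ (3).

module Submission where

open import Defs
open import Data.Bool using (Bool; true; false; not; T; _∨_; if_then_else_)
open import Data.Bool.Properties using (T-≡; T-not-≡; ∨-zeroʳ; not-involutive; not-injective; ¬-not) renaming (_≟_ to _≟ᵇ_)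
open import Data.Empty using (⊥; ⊥-elim)
open import Data.Fin using (Fin; toℕ; fromℕ<) renaming (zero to fz; suc to fs)
open import Data.Fin.Properties using (toℕ-injective; toℕ<n; toℕ-fromℕ<; any?; pigeonhole) renaming (_≟_ to _≟ᶠ_)
open import Data.List using (List; []; _∷_; length; lookup; _++_; applyUpTo; take; drop; allFin; filter; head)
open import Data.List.Membership.Propositional using (_∈_)
open import Data.List.Membership.Propositional.Properties using (∈-filter⁺; ∈-filter⁻; ∈-allFin)
open import Data.List.Properties using (filter-≐; length-applyUpTo; lookup-applyUpTo)
open import Data.List.Relation.Unary.Any using (here; there)
open import Data.Maybe using (fromMaybe)
open import Data.Nat using (ℕ; zero; suc; _+_; _*_; _∸_; _≤_; _<_; z≤n; s≤s; _<?_)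
open import Data.Nat.Induction using (<-rec)
open import Data.Nat.Properties
open import Data.Product using (Σ; _×_; _,_; proj₁; proj₂; ∃; ∃-syntax)
open import Data.Sum using (_⊎_; inj₁; inj₂; [_,_])
open import Data.Unit using (tt)
open import Function using (_∘_)
open import Function.Bundles using (module Equivalence; _⇔_; mk⇔)
open import Function.Definitions using (Injective)
open import Relation.Binary.Definitions using (tri<; tri≈; tri>)
open import Relation.Binary.PropositionalEquality
  using (_≡_; _≢_; refl; sym; trans; cong; cong₂; subst; subst₂; ≢-sym; module ≡-Reasoning)
open import Relation.Nullary using (¬_; Dec; yes; no; does; _×-dec_; _⊎-dec_; ¬?)
open import Relation.Nullary.Decidable using (T?; dec-true; decidable-stable; map′)

open Equivalence using (to; from)

true≢false : true ≢ false
true≢false ()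

not≡⇒≢ : ∀ {x p} → not x ≡ p → x ≢ p
not≡⇒≢ {true} refl ()
not≡⇒≢ {false} refl ()

≡⇒not≢ : ∀ {x p} → x ≡ p → not x ≢ p
≡⇒not≢ {true} refl ()
≡⇒not≢ {false} refl ()

≢⇒not≡ : ∀ {x p} → x ≢ p → not x ≡ p
≢⇒not≡ {true} {false} _ = refl
≢⇒not≡ {true} {true} ne = ⊥-elim (ne refl)
≢⇒not≡ {false} {false} ne = ⊥-elim (ne refl)
≢⇒not≡ {false} {true} _ = refl

not≢⇒≡ : ∀ {x p} → not x ≢ p → x ≡ p
not≢⇒≡ {x} ne = trans (sym (not-involutive x)) (≢⇒not≡ ne)

∨-introˡ : ∀ {a} b → a ≡ true → (a ∨ b) ≡ true
∨-introˡ b a≡ = cong (_∨ b) a≡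

∨-introʳ : ∀ a {b} → b ≡ true → (a ∨ b) ≡ true
∨-introʳ a b≡ = trans (cong (a ∨_) b≡) (∨-zeroʳ a)

bool-ext : ∀ {a b} → (a ≡ true → b ≡ true) → (b ≡ true → a ≡ true) → a ≡ b
bool-ext {true} a⇒b _ = sym (a⇒b refl)
bool-ext {false} {true} _ b⇒a = b⇒a refl
bool-ext {false} {false} _ _ = refl

+-suc² : ∀ i j → i + suc (suc j) ≡ suc (suc (i + j))
+-suc² i j = trans (+-suc i (suc j)) (cong suc (+-suc i j))

double-2+ : ∀ j → 2 * (2 + j) ≡ 4 + (j + j)
double-2+ j rewrite +-identityʳ j | +-suc j (suc j) | +-suc j j = refl

between-suc : ∀ {e g} → e < g → g < 2 + e → g ≡ suc e
between-suc e<g g<2+e = ≤-antisym (≤-pred g<2+e) e<g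

isEven-2+ : ∀ n → isEven (2 + n) ≡ isEven n
isEven-2+ n = not-involutive (isEven n)

isEven-double : ∀ n → isEven (n + n) ≡ true
isEven-double zero = refl
isEven-double (suc n) rewrite +-suc n n = trans (isEven-2+ (n + n)) (isEven-double n)

isEven-+double : ∀ e j → isEven (e + (j + j)) ≡ isEven e
isEven-+double e zero = cong isEven (+-identityʳ e)
isEven-+double e (suc j) = trans (cong isEven (shape e j)) (trans (isEven-2+ (e + (j + j))) (isEven-+double e j))
  where
  shape : ∀ e j → e + (suc j + suc j) ≡ 2 + (e + (j + j))
  shape e j = trans (cong (e +_) (cong suc (+-suc j j))) (+-suc² e (j + j))

isEven-4* : ∀ k → isEven (4 * k) ≡ true
isEven-4* k = trans (cong isEven (*-distribʳ-+ k 2 2)) (isEven-double (2 * k))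

odd-form : ∀ n → isEven n ≡ false → ∃[ h ] n ≡ suc (h + h)
odd-form (suc zero) _ = 0 , refl
odd-form (suc (suc n)) q with odd-form n (trans (sym (isEven-2+ n)) q)
... | h , n≡ = suc h , cong (suc ∘ suc) (trans n≡ (sym (+-suc h h)))

even-form : ∀ n → isEven n ≡ true → ∃[ h ] n ≡ h + h
even-form zero _ = 0 , refl
even-form (suc (suc n)) q with even-form n (trans (sym (isEven-2+ n)) q)
... | h , n≡ = suc h , cong suc (trans (cong suc n≡) (sym (+-suc h h)))

odd-gap : ∀ {i s} → i < s → isEven i ≢ isEven s → ∃[ h ] s ≡ i + suc (h + h)
odd-gap {zero} {s} _ ne = odd-form s (sym (≢⇒not≡ ne))
odd-gap {suc i} {suc s} (s≤s i<s) ne with odd-gap i<s (ne ∘ cong not)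
... | h , s≡ = h , cong suc s≡

injective-upTo : ∀ {A : Set} {j} (f : ℕ → A) → (∀ {a b} → a < b → b ≤ j → f a ≢ f b) →
  ∀ {a b} → a ≤ j → b ≤ j → f a ≡ f b → a ≡ b
injective-upTo f distinct {a} {b} a≤j b≤j e with <-cmp a b
... | tri< a<b _ _ = ⊥-elim (distinct a<b b≤j e)
... | tri≈ _ a≡b _ = a≡b
... | tri> _ _ b<a = ⊥-elim (distinct b<a a≤j (sym e))

below-suc : ∀ {Q : ℕ → Set} {N} → (∀ i → i < N → Q i) → Q N → ∀ i → i < suc N → Q i
below-suc below QN i i<1+N = [ below i , (λ { refl → QN }) ] (m<1+n⇒m<n∨m≡n i<1+N)

least? : ∀ {P : ℕ → Set} → (∀ i → Dec (P i)) → ∀ N →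
  (∃[ i ] (i < N × P i × ∀ j → j < i → ¬ P j)) ⊎ (∀ i → i < N → ¬ P i)
least? P? zero = inj₂ (λ _ ())
least? P? (suc N) with least? P? N
... | inj₁ (i , i<N , Pi , below) = inj₁ (i , m<n⇒m<1+n i<N , Pi , below)
... | inj₂ none with P? N
...   | yes PN = inj₁ (N , ≤-refl , PN , none)
...   | no ¬PN = inj₂ (below-suc none ¬PN)

greatest? : ∀ {P : ℕ → Set} → (∀ i → Dec (P i)) → ∀ N →
  (∃[ i ] (i < N × P i × ∀ j → i < j → j < N → ¬ P j)) ⊎ (∀ i → i < N → ¬ P i)
greatest? P? zero = inj₂ (λ _ ())
greatest? P? (suc N) with P? N
... | yes PN = inj₁ (N , ≤-refl , PN , λ j N<j j<1+N _ → <⇒≱ N<j (≤-pred j<1+N))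
... | no ¬PN with greatest? P? N
...   | inj₁ (i , i<N , Pi , above) =
  inj₁ (i , m<n⇒m<1+n i<N , Pi , λ j i<j j<1+N → below-suc (λ k k<N i<k → above k i<k k<N) (λ _ → ¬PN) j j<1+N i<j)
...   | inj₂ none = inj₂ (below-suc none ¬PN)

alternating-parity : ∀ (f : ℕ → Bool) L → (∀ e → suc e < L → f (suc e) ≡ not (f e)) →
  ∀ e → e < L → isEven e ≡ f 0 → f e ≡ true
alternating-parity f L alt zero _ p = sym p
alternating-parity f L alt (suc zero) 1<L p = trans (alt 0 1<L) (cong not (sym p))
alternating-parity f L alt (suc (suc e)) 2+e<L p = begin
  f (2 + e)        ≡⟨ alt (suc e) 2+e<L ⟩
  not (f (1 + e))  ≡⟨ cong not (alt e (<-trans (n<1+n _) 2+e<L)) ⟩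
  not (not (f e))  ≡⟨ not-involutive _ ⟩
  f e              ≡⟨ alternating-parity f L alt e (<-trans (n<1+n e) (<-trans (n<1+n _) 2+e<L)) (trans (sym (isEven-2+ e)) p) ⟩
  true             ∎
  where open ≡-Reasoning

OrientedAs : (H : Digraph) → Bool → Fin (size H) → Fin (size H) → Set
OrientedAs H true  u v = Arc H u v
OrientedAs H false u v = Arc H v u

oriented-map : ∀ {F H} {f : Fin (size F) → Fin (size H)} → IsHom F H f →
  ∀ d {u v} → OrientedAs F d u v → OrientedAs H d (f u) (f v)
oriented-map hom true  a = hom _ _ a
oriented-map hom false a = hom _ _ a

oriented-nbr : ∀ H d {u v} → OrientedAs H d u v → Nbr H u v
oriented-nbr H true  a = inj₁ a
oriented-nbr H false a = inj₂ a

nbr-sym : ∀ G {x y} → Nbr G x y → Nbr G y x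
nbr-sym G (inj₁ a) = inj₂ a
nbr-sym G (inj₂ a) = inj₁ a

nbr-reverse : ∀ {G x y} → Nbr G x y → arc G x y ≡ false → Arc G y x
nbr-reverse (inj₁ a) e = ⊥-elim (subst T e a)
nbr-reverse (inj₂ a) _ = a

nbr-oriented : ∀ {G x y} → Nbr G x y → OrientedAs G (arc G x y) x y
nbr-oriented {G} {x} {y} n with arc G x y in e
nbr-oriented _ | true = from T-≡ e
nbr-oriented (inj₂ a) | false = a

-- The same as an iot-homomorphism from the oriented path with arc directions D 0, …, D (L ∸ 1) to H;
-- see walk⇒pathHom and pathHom⇒walk.
record OrientedWalk (H : Digraph) (D : ℕ → Bool) (L : ℕ) : Set where
  field
    vertex          : ℕ → Fin (size H)
    oriented        : ∀ i → i < L → OrientedAs H (D i) (vertex i) (vertex (suc i))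
    nonbacktracking : ∀ i → 2 + i ≤ L → vertex (2 + i) ≢ vertex i

restrict : ∀ {H D L L'} → L' ≤ L → OrientedWalk H D L → OrientedWalk H D L'
restrict L'≤L W = record
  { vertex = vertex
  ; oriented = λ i i< → oriented i (≤-trans i< L'≤L)
  ; nonbacktracking = λ i i≤ → nonbacktracking i (≤-trans i≤ L'≤L)
  }
  where open OrientedWalk W

walk-cong : ∀ {H D D' L} → (∀ i → i < L → D i ≡ D' i) → OrientedWalk H D L → OrientedWalk H D' L
walk-cong {H} D≡ W = record
  { vertex = vertex
  ; oriented = λ i i<L → subst (λ d → OrientedAs H d _ _) (D≡ i i<L) (oriented i i<L)
  ; nonbacktracking = nonbacktracking
  }
  where open OrientedWalk W

shift-walk : ∀ {H D L} → OrientedWalk H D L → ∀ i {K} → i + K ≤ L → OrientedWalk H (D ∘ (i +_)) K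
shift-walk {H} {D} W i {K} i+K≤L = record
  { vertex = vertex ∘ (i +_)
  ; oriented = λ j j<K → subst (OrientedAs H (D (i + j)) (vertex (i + j)) ∘ vertex) (sym (+-suc i j))
                                (oriented (i + j) (≤-trans (subst (_≤ i + K) (+-suc i j) (+-monoʳ-≤ i j<K)) i+K≤L))
  ; nonbacktracking = λ j 2+j≤K → nonbacktracking (i + j) (≤-trans (subst (_≤ i + K) i+2+j (+-monoʳ-≤ i 2+j≤K)) i+K≤L)
                                 ∘ trans (cong vertex (sym i+2+j))
  }
  where
  open OrientedWalk W
  i+2+j : ∀ {j} → i + (2 + j) ≡ 2 + (i + j)
  i+2+j {j} = trans (+-suc i (suc j)) (cong suc (+-suc i j))

data PathArc (ds : List Bool) : ℕ → ℕ → Set where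
  forward  : ∀ {i} → i < length ds → at ds i ≡ true  → PathArc ds i (suc i)
  backward : ∀ {i} → i < length ds → at ds i ≡ false → PathArc ds (suc i) i

pathArc-cons : ∀ {d ds a b} → PathArc ds a b → PathArc (d ∷ ds) (suc a) (suc b)
pathArc-cons (forward i< e) = forward (s≤s i<) e
pathArc-cons (backward i< e) = backward (s≤s i<) e

pArc-true : ∀ ds {a b} → pArc ds a b ≡ true → PathArc ds a b
pArc-true (d ∷ ds) {zero} {suc zero} e = forward (s≤s z≤n) e
pArc-true (d ∷ ds) {suc zero} {zero} e = backward (s≤s z≤n) (trans (sym (not-involutive d)) (cong not e))
pArc-true (d ∷ ds) {suc zero} {suc b} e = pathArc-cons (pArc-true ds e)
pArc-true (d ∷ ds) {suc (suc a)} {suc b} e = pathArc-cons (pArc-true ds e)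
pArc-true (d ∷ ds) {zero} {zero} ()
pArc-true (d ∷ ds) {zero} {suc (suc b)} ()
pArc-true (d ∷ ds) {suc (suc a)} {zero} ()

pArc-forward : ∀ ds i → i < length ds → pArc ds i (suc i) ≡ at ds i
pArc-forward (d ∷ ds) zero _ = refl
pArc-forward (d ∷ ds) (suc zero) (s≤s i<) = pArc-forward ds zero i<
pArc-forward (d ∷ ds) (suc (suc i)) (s≤s i<) = pArc-forward ds (suc i) i<

pArc-backward : ∀ ds i → i < length ds → pArc ds (suc i) i ≡ not (at ds i)
pArc-backward (d ∷ ds) zero _ = refl
pArc-backward (d ∷ ds) (suc zero) (s≤s i<) = pArc-backward ds zero i<
pArc-backward (d ∷ ds) (suc (suc i)) (s≤s i<) = pArc-backward ds (suc i) i<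

walk-pathArc : ∀ {H D L ds} (W : OrientedWalk H D L) → (∀ i → i < length ds → D i ≡ at ds i) → length ds ≤ L →
  ∀ {a b} → PathArc ds a b → Arc H (OrientedWalk.vertex W a) (OrientedWalk.vertex W b)
walk-pathArc {H} W D≡ len≤L (forward i< d) =
  subst (λ d → OrientedAs H d _ _) (trans (D≡ _ i<) d) (OrientedWalk.oriented W _ (≤-trans i< len≤L))
walk-pathArc {H} W D≡ len≤L (backward i< d) =
  subst (λ d → OrientedAs H d _ _) (trans (D≡ _ i<) d) (OrientedWalk.oriented W _ (≤-trans i< len≤L))

data Adjacent (L : ℕ) : ℕ → ℕ → Set where
  right : ∀ {i} → i < L → Adjacent L i (suc i)
  left  : ∀ {i} → i < L → Adjacent L (suc i) i

pathArc-adjacent : ∀ {ds a b} → PathArc ds a b → Adjacent (length ds) a b × Adjacent (length ds) b a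
pathArc-adjacent (forward i< _) = right i< , left i<
pathArc-adjacent (backward i< _) = left i< , right i<

pathNbr-adjacent : ∀ ds {x y} → Nbr (pathG ds) x y → Adjacent (length ds) (toℕ x) (toℕ y)
pathNbr-adjacent ds (inj₁ a) = proj₁ (pathArc-adjacent (pArc-true ds (to T-≡ a)))
pathNbr-adjacent ds (inj₂ a) = proj₂ (pathArc-adjacent (pArc-true ds (to T-≡ a)))

adjacent-injective : ∀ {A : Set} {L} (h : ℕ → A) → (∀ i → 2 + i ≤ L → h (2 + i) ≢ h i) →
  ∀ {a b c} → Adjacent L a b → Adjacent L a c → h b ≡ h c → b ≡ c
adjacent-injective h nb (right _) (right _) _ = refl
adjacent-injective h nb (left _) (left _) _ = refl
adjacent-injective h nb (right i<) (left _) e = ⊥-elim (nb _ i< e)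
adjacent-injective h nb (left _) (right i<) e = ⊥-elim (nb _ i< (sym e))

walk⇒pathHom : ∀ {H} ds → OrientedWalk H (at ds) (length ds) → IotHom (pathG ds) H
walk⇒pathHom {H} ds W = vertex ∘ toℕ , hom , iot
  where
  open OrientedWalk W
  hom : IsHom (pathG ds) H (vertex ∘ toℕ)
  hom x y a = walk-pathArc W (λ _ _ → refl) ≤-refl (pArc-true ds (to T-≡ a))
  iot : IotInjective (pathG ds) H (vertex ∘ toℕ)
  iot x y z ny nz e = toℕ-injective
    (adjacent-injective vertex nonbacktracking (pathNbr-adjacent ds ny) (pathNbr-adjacent ds nz) e)

clamp : ∀ L → ℕ → Fin (suc L)
clamp L zero = fz
clamp zero (suc i) = fz
clamp (suc L) (suc i) = fs (clamp L i)

toℕ-clamp : ∀ L {i} → i ≤ L → toℕ (clamp L i) ≡ i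
toℕ-clamp L {zero} _ = refl
toℕ-clamp (suc L) {suc i} (s≤s i≤) = cong suc (toℕ-clamp L i≤)

clamp-oriented : ∀ ds i → i < length ds →
  OrientedAs (pathG ds) (at ds i) (clamp (length ds) i) (clamp (length ds) (suc i))
clamp-oriented ds i i< with at ds i in d
... | true = from T-≡ (trans ends (trans (pArc-forward ds i i<) d))
  where ends = cong₂ (pArc ds) (toℕ-clamp _ (<⇒≤ i<)) (toℕ-clamp _ i<)
... | false = from T-≡ (trans ends (trans (pArc-backward ds i i<) (cong not d)))
  where ends = cong₂ (pArc ds) (toℕ-clamp _ i<) (toℕ-clamp _ (<⇒≤ i<))

pathHom⇒walk : ∀ {H} ds → IotHom (pathG ds) H → OrientedWalk H (at ds) (length ds)
pathHom⇒walk {H} ds (f , hom , iot) = record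
  { vertex = f ∘ clamp L
  ; oriented = λ i i< → oriented-map hom (at ds i) (clamp-oriented ds i i<)
  ; nonbacktracking = nonbacktracking
  }
  where
  L = length ds
  nonbacktracking : ∀ i → 2 + i ≤ L → f (clamp L (2 + i)) ≢ f (clamp L i)
  nonbacktracking i 2+i≤ e = m≢2+m i (begin
      i                        ≡⟨ toℕ-clamp L (≤-trans (n≤1+n i) (<⇒≤ 2+i≤)) ⟨
      toℕ (clamp L i)          ≡⟨ cong toℕ (iot (clamp L (suc i)) _ _ behind ahead (sym e)) ⟩
      toℕ (clamp L (2 + i))    ≡⟨ toℕ-clamp L 2+i≤ ⟩
      2 + i                    ∎)
    where
    open ≡-Reasoning
    m≢2+m : ∀ m → m ≢ 2 + m
    m≢2+m m = <⇒≢ (m<n+m m (s≤s z≤n))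
    behind : Nbr (pathG ds) (clamp L (suc i)) (clamp L i)
    behind = nbr-sym (pathG ds) (oriented-nbr (pathG ds) (at ds i) (clamp-oriented ds i (≤-trans (n≤1+n _) 2+i≤)))
    ahead : Nbr (pathG ds) (clamp L (suc i)) (clamp L (2 + i))
    ahead = oriented-nbr (pathG ds) (at ds (suc i)) (clamp-oriented ds (suc i) 2+i≤)

at-applyUpTo : ∀ (f : ℕ → Bool) n {i} → i < n → at (applyUpTo f n) i ≡ f i
at-applyUpTo f (suc n) {zero} _ = refl
at-applyUpTo f (suc n) {suc i} (s≤s i<n) = at-applyUpTo (f ∘ suc) n i<n

take-applyUpTo : ∀ (f : ℕ → Bool) {m n} → m ≤ n → take m (applyUpTo f n) ≡ applyUpTo f m
take-applyUpTo f {zero} _ = refl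
take-applyUpTo f {suc m} {suc n} (s≤s m≤n) = cong (f 0 ∷_) (take-applyUpTo (f ∘ suc) m≤n)

tabulate-walk : ∀ {H D L} → OrientedWalk H D L → OrientedWalk H (at (applyUpTo D L)) (length (applyUpTo D L))
tabulate-walk {D = D} {L} W =
  subst (OrientedWalk _ _) (sym (length-applyUpTo D L)) (walk-cong (λ i i<L → sym (at-applyUpTo D L i<L)) W)

walk⇒tabulatedPathHom : ∀ {H D L} → OrientedWalk H D L → IotHom (pathG (applyUpTo D L)) H
walk⇒tabulatedPathHom {D = D} {L} W = walk⇒pathHom (applyUpTo D L) (tabulate-walk W)

-- Positions 0 … m of the cycle on m vertices unrolled into a path; both 0 and m stand for the vertex 0.
data Lift (m : ℕ) : ℕ → ℕ → Set where
  same : ∀ {a} → Lift m a a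
  top  : Lift m 0 m

wrap-lift : ∀ ds a → Lift (length ds) a (wrap ds a)
wrap-lift ds zero = top
wrap-lift ds (suc a) = same

cArc-true : ∀ ds {a b} → cArc ds a b ≡ true →
  ∃[ a' ] ∃[ b' ] (Lift (length ds) a a' × Lift (length ds) b b' × PathArc ds a' b')
cArc-true ds {a} {b} e with pArc ds a b in e₁ | pArc ds (wrap ds a) b in e₂
... | true | _ = a , b , same , same , pArc-true ds e₁
... | false | true = wrap ds a , b , wrap-lift ds a , same , pArc-true ds e₂
... | false | false = a , wrap ds b , same , wrap-lift ds b , pArc-true ds e

data CycleStep (m : ℕ) : ℕ → ℕ → Set where
  step  : ∀ {a} → suc a < m → CycleStep m a (suc a)
  close : ∀ {a} → suc a ≡ m → CycleStep m a 0

lifted-step : ∀ {m a b i} → Lift m a i → Lift m b (suc i) → i < m → b < m → CycleStep m a b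
lifted-step same same _ b< = step b<
lifted-step same top _ _ = close refl
lifted-step top _ i< _ = ⊥-elim (<-irrefl refl i<)

cycleNbr-step : ∀ ds {x y} → Nbr (cycleG ds) x y →
  CycleStep (length ds) (toℕ x) (toℕ y) ⊎ CycleStep (length ds) (toℕ y) (toℕ x)
cycleNbr-step ds {x} {y} (inj₁ a) with cArc-true ds (to T-≡ a)
... | _ , _ , la , lb , forward i< _ = inj₁ (lifted-step la lb i< (toℕ<n y))
... | _ , _ , la , lb , backward i< _ = inj₂ (lifted-step lb la i< (toℕ<n x))
cycleNbr-step ds {x} {y} (inj₂ a) with cArc-true ds (to T-≡ a)
... | _ , _ , la , lb , forward i< _ = inj₂ (lifted-step la lb i< (toℕ<n x))
... | _ , _ , la , lb , backward i< _ = inj₁ (lifted-step lb la i< (toℕ<n y))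

successor-unique : ∀ {m a b c} → CycleStep m a b → CycleStep m a c → b ≡ c
successor-unique (step _) (step _) = refl
successor-unique (close _) (close _) = refl
successor-unique (step a<) (close refl) = ⊥-elim (<-irrefl refl a<)
successor-unique (close refl) (step a<) = ⊥-elim (<-irrefl refl a<)

predecessor-unique : ∀ {m a b c} → CycleStep m b a → CycleStep m c a → b ≡ c
predecessor-unique (step _) (step _) = refl
predecessor-unique (close e) (close e') = suc-injective (trans e (sym e'))

closedWalk-distinct : ∀ {A : Set} {m} (h : ℕ → A) → (∀ i → 2 + i ≤ suc m → h (2 + i) ≢ h i) →
  h m ≡ h 0 → h (suc m) ≡ h 1 → ∀ {a b c} → CycleStep m a b → CycleStep m c a → h b ≢ h c
closedWalk-distinct h nb _ _ (step b<) (step _) = nb _ (≤-trans (n≤1+n _) (≤-trans b< (n≤1+n _)))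
closedWalk-distinct h nb _ h1 (step _) (close refl) e = nb _ ≤-refl (trans h1 e)
closedWalk-distinct h nb h0 _ (close refl) (step _) e = nb _ (n≤1+n _) (trans h0 e)
closedWalk-distinct h nb h0 h1 (close refl) (close refl) _ = nb 0 ≤-refl (trans h1 h0)

closedWalk⇒cycleHom : ∀ {H D} ds (W : OrientedWalk H D (suc (length ds))) →
  (∀ i → i < length ds → D i ≡ at ds i) →
  OrientedWalk.vertex W (length ds) ≡ OrientedWalk.vertex W 0 →
  OrientedWalk.vertex W (suc (length ds)) ≡ OrientedWalk.vertex W 1 →
  IotHom (cycleG ds) H
closedWalk⇒cycleHom {H} {D} ds W D≡ closeₘ close₁ = vertex ∘ toℕ , hom , iot
  where
  open OrientedWalk W
  lifted : ∀ {a a'} → Lift (length ds) a a' → vertex a' ≡ vertex a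
  lifted same = refl
  lifted top = closeₘ
  hom : IsHom (cycleG ds) H (vertex ∘ toℕ)
  hom x y a with cArc-true ds (to T-≡ a)
  ... | _ , _ , la , lb , pa = subst₂ (Arc H) (lifted la) (lifted lb) (walk-pathArc W D≡ (n≤1+n _) pa)
  iot : IotInjective (cycleG ds) H (vertex ∘ toℕ)
  iot x y z ny nz e with cycleNbr-step ds ny | cycleNbr-step ds nz
  ... | inj₁ sy | inj₁ sz = toℕ-injective (successor-unique sy sz)
  ... | inj₂ sy | inj₂ sz = toℕ-injective (predecessor-unique sy sz)
  ... | inj₁ sy | inj₂ sz = ⊥-elim (closedWalk-distinct vertex nonbacktracking closeₘ close₁ sy sz e)
  ... | inj₂ sy | inj₁ sz = ⊥-elim (closedWalk-distinct vertex nonbacktracking closeₘ close₁ sz sy (sym e))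

-- The arcs at the positions of parity p alternate in direction: they form an alternating matching.
ParityAlternating : (ℕ → Bool) → Bool → ℕ → Set
ParityAlternating D p L = ∀ e → isEven e ≡ p → 2 + e < L → D (2 + e) ≢ D e

start : Bool → ℕ
start true = 0
start false = 1

isEven-start : ∀ p → isEven (start p) ≡ p
isEven-start true = refl
isEven-start false = refl

⟦_⟧ : Bool → Fin 2
⟦ false ⟧ = fz
⟦ true ⟧ = fs fz

⟦⟧-not : ∀ b → ⟦ not b ⟧ ≢ ⟦ b ⟧
⟦⟧-not true ()
⟦⟧-not false ()

T2r-loop : ∀ d b → OrientedAs T2r d ⟦ b ⟧ ⟦ b ⟧
T2r-loop true true = tt
T2r-loop true false = tt
T2r-loop false true = tt
T2r-loop false false = tt

T2r-rise : ∀ d → OrientedAs T2r d ⟦ not d ⟧ ⟦ d ⟧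
T2r-rise true = tt
T2r-rise false = tt

T2r-step : ∀ d {u v} → OrientedAs T2r d u v → u ≢ v → u ≡ ⟦ not d ⟧ × v ≡ ⟦ d ⟧
T2r-step true {fz} {fs fz} _ _ = refl , refl
T2r-step false {fs fz} {fz} _ _ = refl , refl
T2r-step d {fz} {fz} _ ne = ⊥-elim (ne refl)
T2r-step d {fs fz} {fs fz} _ ne = ⊥-elim (ne refl)
T2r-step true {fs fz} {fz} () _
T2r-step false {fz} {fs fz} () _

fin2-pigeonhole : ∀ {a b c : Fin 2} → a ≢ b → a ≢ c → b ≡ c
fin2-pigeonhole {fz} {fz} a≢b _ = ⊥-elim (a≢b refl)
fin2-pigeonhole {fz} {fs fz} {fz} _ a≢c = ⊥-elim (a≢c refl)
fin2-pigeonhole {fz} {fs fz} {fs fz} _ _ = refl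
fin2-pigeonhole {fs fz} {fz} {fz} _ _ = refl
fin2-pigeonhole {fs fz} {fz} {fs fz} _ a≢c = ⊥-elim (a≢c refl)
fin2-pigeonhole {fs fz} {fs fz} a≢b _ = ⊥-elim (a≢b refl)

-- The label (true for t₁) changes exactly across the arcs at the positions of parity p, rising from t₀ to t₁
-- in the direction of the arc.
parityLabel : (ℕ → Bool) → Bool → ℕ → Bool
parityLabel D p zero = not (D (start p))
parityLabel D p (suc i) with isEven i ≟ᵇ p
... | yes _ = D i
... | no _ = parityLabel D p i

module _ (D : ℕ → Bool) (p : Bool) where
  private
    label = parityLabel D p

  label-rise : ∀ {i} → isEven i ≡ p → label (suc i) ≡ D i
  label-rise {i} q with isEven i ≟ᵇ p
  ... | yes _ = refl
  ... | no q' = ⊥-elim (q' q)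

  label-stay : ∀ {i} → isEven i ≢ p → label (suc i) ≡ label i
  label-stay {i} q with isEven i ≟ᵇ p
  ... | yes q' = ⊥-elim (q q')
  ... | no _ = refl

  module _ {L} (alt : ParityAlternating D p L) where
    label-tail : ∀ e → isEven e ≡ p → e < L → label e ≡ not (D e)
    label-tail zero refl _ = refl
    label-tail (suc zero) refl _ = label-stay {0} (λ ())
    label-tail (suc (suc e)) q 2+e<L = begin
      label (2 + e)      ≡⟨ label-stay {suc e} (not≡⇒≢ q) ⟩
      label (1 + e)      ≡⟨ label-rise q' ⟩
      D e                ≡⟨ ¬-not (≢-sym (alt e q' 2+e<L)) ⟩
      not (D (2 + e))    ∎
      where
      open ≡-Reasoning
      q' = trans (sym (isEven-2+ e)) q

    label-flips : ∀ i → 2 + i ≤ L → label (2 + i) ≡ not (label i)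
    label-flips i 2+i≤L with isEven i ≟ᵇ p
    ... | yes q = begin
      label (2 + i)      ≡⟨ label-stay {suc i} (≡⇒not≢ q) ⟩
      label (1 + i)      ≡⟨ label-rise q ⟩
      D i                ≡⟨ not-involutive _ ⟨
      not (not (D i))    ≡⟨ cong not (label-tail i q (≤-trans (n≤1+n _) 2+i≤L)) ⟨
      not (label i)      ∎
      where open ≡-Reasoning
    ... | no q = begin
      label (2 + i)      ≡⟨ label-rise q' ⟩
      D (1 + i)          ≡⟨ not-involutive _ ⟨
      not (not (D (1 + i))) ≡⟨ cong not (label-tail (suc i) q' 2+i≤L) ⟨
      not (label (1 + i)) ≡⟨ cong not (label-stay {i} q) ⟩
      not (label i)      ∎
      where
      open ≡-Reasoning
      q' = ≢⇒not≡ q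

    label-oriented : ∀ i → i < L → OrientedAs T2r (D i) ⟦ label i ⟧ ⟦ label (suc i) ⟧
    label-oriented i i<L with isEven i ≟ᵇ p
    ... | yes q = subst (λ b → OrientedAs T2r (D i) ⟦ b ⟧ ⟦ D i ⟧) (sym (label-tail i q i<L)) (T2r-rise (D i))
    ... | no _ = T2r-loop (D i) (label i)

parityAlternating⇒T2rWalk : ∀ {D p L} → ParityAlternating D p L → OrientedWalk T2r D L
parityAlternating⇒T2rWalk {D} {p} alt = record
  { vertex = λ i → ⟦ parityLabel D p i ⟧
  ; oriented = label-oriented D p alt
  ; nonbacktracking = λ i 2+i≤L e → ⟦⟧-not _ (trans (cong ⟦_⟧ (sym (label-flips D p alt i 2+i≤L))) e)
  }

module _ {D : ℕ → Bool} {L : ℕ} (W : OrientedWalk T2r D L) where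
  open OrientedWalk W renaming (vertex to v)

  private
    Changes : ℕ → Set
    Changes e = v (suc e) ≢ v e

    change-then-stay : ∀ e → 2 + e ≤ L → Changes e → v (2 + e) ≡ v (1 + e)
    change-then-stay e 2+e≤L ch = fin2-pigeonhole (≢-sym (nonbacktracking e 2+e≤L)) (≢-sym ch)

    stay-then-change : ∀ e → 2 + e ≤ L → v (1 + e) ≡ v e → Changes (suc e)
    stay-then-change e 2+e≤L st eq = nonbacktracking e 2+e≤L (trans eq st)

    module _ (p : Bool) (ch₀ : true ≡ p → Changes 0) (st₀ : true ≢ p → v 1 ≡ v 0) where
      changes-parity : ∀ e → suc e ≤ L → (isEven e ≡ p → Changes e) × (isEven e ≢ p → v (suc e) ≡ v e)
      changes-parity zero _ = ch₀ , st₀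
      changes-parity (suc e) 2+e≤L with changes-parity e (≤-trans (n≤1+n _) 2+e≤L)
      ... | ch , st = (λ q → stay-then-change e 2+e≤L (st (not≡⇒≢ q)))
                    , (λ q → change-then-stay e 2+e≤L (ch (not≢⇒≡ q)))

      alternates : ParityAlternating D p L
      alternates e q 2+e<L eq = ⟦⟧-not (D e) (begin
        ⟦ not (D e) ⟧          ≡⟨ cong (⟦_⟧ ∘ not) eq ⟨
        ⟦ not (D (2 + e)) ⟧    ≡⟨ proj₁ (T2r-step (D (2 + e)) (oriented (2 + e) 2+e<L) (≢-sym ch₂)) ⟨
        v (2 + e)              ≡⟨ proj₂ (changes-parity (suc e) (<⇒≤ 2+e<L)) (≡⇒not≢ q) ⟩
        v (1 + e)              ≡⟨ proj₂ (T2r-step (D e) (oriented e e<L) (≢-sym ch₀')) ⟩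
        ⟦ D e ⟧                ∎)
        where
        open ≡-Reasoning
        e<L = <-trans (n<1+n e) (<-trans (n<1+n _) 2+e<L)
        ch₀' = proj₁ (changes-parity e e<L) q
        ch₂ = proj₁ (changes-parity (2 + e) 2+e<L) (trans (isEven-2+ e) q)

  T2rWalk⇒parityAlternating : ∃[ p ] ParityAlternating D p L
  T2rWalk⇒parityAlternating with v 1 ≟ᶠ v 0
  ... | yes stay₀ = false , alternates false (λ ()) (λ _ → stay₀)
  ... | no change₀ = true , alternates true (λ _ → change₀) (λ ne → ⊥-elim (ne refl))

T2rWalk-period4 : ∀ {D L} (W : OrientedWalk T2r D L) → ∀ k r → 4 * k + r ≤ L →
  OrientedWalk.vertex W (4 * k + r) ≡ OrientedWalk.vertex W r
T2rWalk-period4 W zero r _ = refl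
T2rWalk-period4 {L = L} W (suc k) r 4[1+k]+r≤L = begin
  v (4 * suc k + r)      ≡⟨ cong v shape ⟩
  v (4 + (4 * k + r))    ≡⟨ fin2-pigeonhole (≢-sym (nonbacktracking (2 + (4 * k + r)) 4+i≤L)) (nonbacktracking i 2+i≤L) ⟩
  v (4 * k + r)          ≡⟨ T2rWalk-period4 W k r (≤-trans (m≤n+m _ 4) 4+i≤L) ⟩
  v r                    ∎
  where
  open OrientedWalk W renaming (vertex to v)
  open ≡-Reasoning
  i = 4 * k + r
  shape : 4 * suc k + r ≡ 4 + i
  shape = trans (cong (_+ r) (*-suc 4 k)) (+-assoc 4 (4 * k) r)
  4+i≤L : 4 + i ≤ L
  4+i≤L = subst (_≤ L) shape 4[1+k]+r≤L
  2+i≤L : 2 + i ≤ L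
  2+i≤L = ≤-trans (m≤n+m _ 2) 4+i≤L

parityAlternating-pathHom : ∀ {ds p} → ParityAlternating (at ds) p (length ds) → IotHom (pathG ds) T2r
parityAlternating-pathHom {ds} alt = walk⇒pathHom ds (parityAlternating⇒T2rWalk alt)

parity-iterate : ∀ {D p L} → ParityAlternating D p L → ∀ j → start p + (j + j) < L →
  D (start p + (j + j)) ≡ (if isEven j then D (start p) else not (D (start p)))
parity-iterate {D} {p} alt zero _ = cong D (+-identityʳ _)
parity-iterate {D} {p} {L} alt (suc j) <L = begin
  D (start p + (suc j + suc j))                     ≡⟨ cong D shape ⟩
  D (2 + e)                                         ≡⟨ ¬-not (alt e (trans (isEven-+double (start p) j) (isEven-start p)) (subst (_< L) shape <L)) ⟩
  not (D e)                                         ≡⟨ cong not (parity-iterate alt j (<-trans (n<1+n _) (<-trans (n<1+n _) (subst (_< L) shape <L)))) ⟩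
  not (if isEven j then D (start p) else not (D (start p)))  ≡⟨ flip (isEven j) ⟩
  (if isEven (suc j) then D (start p) else not (D (start p))) ∎
  where
  open ≡-Reasoning
  e = start p + (j + j)
  shape : start p + (suc j + suc j) ≡ 2 + e
  shape = trans (cong (start p +_) (cong suc (+-suc j j))) (+-suc² (start p) (j + j))
  flip : ∀ b → not (if b then D (start p) else not (D (start p))) ≡ (if not b then D (start p) else not (D (start p)))
  flip true = refl
  flip false = not-involutive _

extend : ∀ {n} → (Fin n → Bool) → ℕ → Bool
extend {zero} M _ = false
extend {suc n} M zero = M fz
extend {suc n} M (suc e) = extend (M ∘ fs) e

extend-toℕ : ∀ {n} (M : Fin n → Bool) i → extend M (toℕ i) ≡ M i
extend-toℕ M fz = refl
extend-toℕ M (fs i) = extend-toℕ (M ∘ fs) i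

extend-fromℕ< : ∀ {n e} (M : Fin n → Bool) (e< : e < n) → M (fromℕ< e<) ≡ extend M e
extend-fromℕ< M e< = trans (sym (extend-toℕ M _)) (cong (extend M) (toℕ-fromℕ< e<))

lookup-at : ∀ ds (e : Fin (length ds)) → lookup ds e ≡ at ds (toℕ e)
lookup-at (d ∷ ds) fz = refl
lookup-at (d ∷ ds) (fs e) = lookup-at ds e

lookup-fromℕ< : ∀ ds {e} (e< : e < length ds) → lookup ds (fromℕ< e<) ≡ at ds e
lookup-fromℕ< ds e< = trans (lookup-at ds _) (cong (at ds) (toℕ-fromℕ< e<))

exactly-one⇒flips : ∀ (m : ℕ → Bool) e → (m e ≡ true → m (suc e) ≢ true) → (m e ≡ false → m (suc e) ≢ false) →
  m (suc e) ≡ not (m e)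
exactly-one⇒flips m e not-both not-neither with m e | m (suc e)
... | true | false = refl
... | false | true = refl
... | true | true = ⊥-elim (not-both refl refl)
... | false | false = ⊥-elim (not-neither refl refl)

module _ {ds M} (am : AltMatchingPath ds M) where
  private
    L = length ds
    m = extend M
    matching = proj₁ am
    saturated = proj₁ (proj₂ am)
    alternating = proj₂ (proj₂ am)

    matched-flips : ∀ e → suc e < L → m (suc e) ≡ not (m e)
    matched-flips e 1+e<L = exactly-one⇒flips m e not-both not-neither
      where
      e<L = <-trans (n<1+n e) 1+e<L
      not-both : m e ≡ true → m (suc e) ≢ true
      not-both me m1e = matching (fromℕ< e<L) (fromℕ< 1+e<L)
        (trans (extend-fromℕ< M e<L) me) (trans (extend-fromℕ< M 1+e<L) m1e)
        (trans (toℕ-fromℕ< 1+e<L) (cong suc (sym (toℕ-fromℕ< e<L))))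
      not-neither : m e ≡ false → m (suc e) ≢ false
      not-neither me m1e with saturated (suc e) (s≤s z≤n) 1+e<L
      ... | f , Mf , inj₁ f≡ = true≢false (trans (sym Mf) (trans (sym (extend-toℕ M f)) (trans (cong m f≡) m1e)))
      ... | f , Mf , inj₂ 1+f≡ = true≢false (trans (sym Mf) (trans (sym (extend-toℕ M f)) (trans (cong m (suc-injective 1+f≡)) me)))

    matched : ∀ {a} (a<L : a < L) → isEven a ≡ m 0 → M (fromℕ< a<L) ≡ true
    matched a<L q = trans (extend-fromℕ< M a<L) (alternating-parity m L matched-flips _ a<L q)

  altMatchingPath⇒parityAlternating : ∃[ p ] ParityAlternating (at ds) p L
  altMatchingPath⇒parityAlternating = m 0 , alternate
    where
    alternate : ParityAlternating (at ds) (m 0) L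
    alternate e q 2+e<L eq = alternating (fromℕ< e<L) (fromℕ< 2+e<L) (matched e<L q) (matched 2+e<L (trans (isEven-2+ e) q))
      (subst₂ _<_ (sym (toℕ-fromℕ< e<L)) (sym (toℕ-fromℕ< 2+e<L)) (<-trans (n<1+n e) (n<1+n _)))
      (λ g a b → middle g (subst (_< toℕ g) (toℕ-fromℕ< e<L) a) (subst (toℕ g <_) (toℕ-fromℕ< 2+e<L) b))
      (trans (lookup-fromℕ< ds e<L) (trans (sym eq) (sym (lookup-fromℕ< ds 2+e<L))))
      where
      open ≡-Reasoning
      e<L = <-trans (n<1+n e) (<-trans (n<1+n _) 2+e<L)
      middle : ∀ g → e < toℕ g → toℕ g < 2 + e → M g ≡ false
      middle g e<g g<2+e = begin
        M g              ≡⟨ extend-toℕ M g ⟨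
        m (toℕ g)        ≡⟨ cong m (between-suc e<g g<2+e) ⟩
        m (suc e)        ≡⟨ matched-flips e (<-trans (n<1+n _) 2+e<L) ⟩
        not (m e)        ≡⟨ cong not (alternating-parity m L matched-flips e e<L q) ⟩
        false            ∎

Selects : ∀ {n} → (Fin n → Bool) → Bool → Set
Selects M p = ∀ e → M e ≡ true ⇔ isEven (toℕ e) ≡ p

parityClass : Bool → ∀ {n} → Fin n → Bool
parityClass p e = does (isEven (toℕ e) ≟ᵇ p)

parityClass-selects : ∀ {n} p → Selects {n} (parityClass p) p
parityClass-selects p e = mk⇔ to' (dec-true (isEven (toℕ e) ≟ᵇ p))
  where
  to' : parityClass p e ≡ true → isEven (toℕ e) ≡ p
  to' h with isEven (toℕ e) ≟ᵇ p
  ... | yes q = q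
  ... | no _ = ⊥-elim (true≢false (sym h))

evens-selects : ∀ {n} → Selects {n} (isEven ∘ toℕ) true
evens-selects e = mk⇔ (λ q → q) (λ q → q)

odds-selects : ∀ {n} → Selects {n} (not ∘ isEven ∘ toℕ) false
odds-selects e = mk⇔ (λ q → not-injective q) (cong not)

parityAlternating⇒altMatchingPath : ∀ ds {p M} → Selects M p → ParityAlternating (at ds) p (length ds) →
  AltMatchingPath ds M
parityAlternating⇒altMatchingPath ds {p} {M} sel alt = matching , saturated , alternating
  where
  L = length ds
  selected : ∀ {e} (e<L : e < L) → isEven e ≡ p → M (fromℕ< e<L) ≡ true
  selected e<L q = from (sel _) (trans (cong isEven (toℕ-fromℕ< e<L)) q)
  matching : ∀ e f → M e ≡ true → M f ≡ true → toℕ f ≡ suc (toℕ e) → ⊥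
  matching e f Me Mf f≡ = ≡⇒not≢ (to (sel e) Me) (trans (cong isEven (sym f≡)) (to (sel f) Mf))
  saturated : ∀ v → 1 ≤ v → v < L → ∃[ e ] (M e ≡ true × (toℕ e ≡ v ⊎ suc (toℕ e) ≡ v))
  saturated v _ v<L with isEven v ≟ᵇ p
  ... | yes q = fromℕ< v<L , selected v<L q , inj₁ (toℕ-fromℕ< v<L)
  saturated (suc v) _ 1+v<L | no q = fromℕ< v<L , selected v<L (not≢⇒≡ q) , inj₂ (cong suc (toℕ-fromℕ< v<L))
    where v<L = <-trans (n<1+n v) 1+v<L
  alternating : ∀ e f → M e ≡ true → M f ≡ true → toℕ e < toℕ f →
    (∀ g → toℕ e < toℕ g → toℕ g < toℕ f → M g ≡ false) → lookup ds e ≢ lookup ds f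
  alternating e f Me Mf e<f between eq with <-cmp (toℕ f) (2 + toℕ e)
  ... | tri< f<2+e _ _ = matching e f Me Mf (≤-antisym (≤-pred f<2+e) e<f)
  ... | tri≈ _ f≡2+e _ = alt (toℕ e) (to (sel e) Me) (subst (_< L) f≡2+e (toℕ<n f))
          (trans (cong (at ds) (sym f≡2+e)) (trans (sym (lookup-at ds f)) (trans (sym eq) (lookup-at ds e))))
  ... | tri> _ _ 2+e<f = true≢false (trans (sym (selected 2+e<L (trans (isEven-2+ (toℕ e)) (to (sel e) Me))))
          (between (fromℕ< 2+e<L) (subst (toℕ e <_) (sym (toℕ-fromℕ< 2+e<L)) (<-trans (n<1+n _) (n<1+n _)))
                                  (subst (_< toℕ f) (sym (toℕ-fromℕ< 2+e<L)) 2+e<f)))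
    where 2+e<L = <-trans 2+e<f (toℕ<n f)

short-parityAlternating : ∀ ds → length ds ≤ 3 → ParityAlternating (at ds) false (length ds)
short-parityAlternating ds L≤3 (suc e) _ 2+e<L _ = <-irrefl refl (≤-trans (≤-trans (s≤s (s≤s (s≤s (s≤s z≤n)))) 2+e<L) L≤3)

at-++ˡ : ∀ xs ys {i} → i < length xs → at (xs ++ ys) i ≡ at xs i
at-++ˡ (x ∷ xs) ys {zero} _ = refl
at-++ˡ (x ∷ xs) ys {suc i} (s≤s i<) = at-++ˡ xs ys i<

at-++ʳ : ∀ xs ys i → at (xs ++ ys) (length xs + i) ≡ at ys i
at-++ʳ [] ys i = refl
at-++ʳ (x ∷ xs) ys i = at-++ʳ xs ys i

module _ {ds M k} (am : AltMatchingCycle ds M) (len : length ds ≡ 4 * k) (1≤k : 1 ≤ k) where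
  private
    n = length ds
    m = extend M
    matching = proj₁ am
    saturated = proj₁ (proj₂ am)
    alternating = proj₂ (proj₂ am)

    4≤n : 4 ≤ n
    4≤n = subst (4 ≤_) (sym len) (*-monoʳ-≤ 4 1≤k)

    n-even : isEven n ≡ true
    n-even = trans (cong isEven len) (isEven-4* k)

    matched-flips : ∀ e → suc e < n → m (suc e) ≡ not (m e)
    matched-flips e 1+e<n = exactly-one⇒flips m e not-both not-neither
      where
      e<n = <-trans (n<1+n e) 1+e<n
      not-both : m e ≡ true → m (suc e) ≢ true
      not-both me m1e = matching (fromℕ< e<n) (fromℕ< 1+e<n)
        (trans (extend-fromℕ< M e<n) me) (trans (extend-fromℕ< M 1+e<n) m1e)
        (inj₁ (trans (toℕ-fromℕ< 1+e<n) (cong suc (sym (toℕ-fromℕ< e<n)))))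
      not-neither : m e ≡ false → m (suc e) ≢ false
      not-neither me m1e with saturated (fromℕ< 1+e<n)
      ... | f , Mf , inj₁ f≡ = true≢false (trans (sym Mf)
            (trans (sym (extend-toℕ M f)) (trans (cong m (trans f≡ (toℕ-fromℕ< 1+e<n))) m1e)))
      ... | f , Mf , inj₂ (inj₁ 1+f≡) = true≢false (trans (sym Mf)
            (trans (sym (extend-toℕ M f)) (trans (cong m (suc-injective (trans 1+f≡ (toℕ-fromℕ< 1+e<n)))) me)))
      ... | f , Mf , inj₂ (inj₂ (_ , v≡0)) with trans (sym (toℕ-fromℕ< 1+e<n)) v≡0
      ...   | ()

    matched : ∀ {a} → a < n → isEven a ≡ m 0 → m a ≡ true
    matched a<n q = alternating-parity m n matched-flips _ a<n q

    alternating-ℕ : ∀ {a b} (a<n : a < n) (b<n : b < n) → m a ≡ true → m b ≡ true → a ≢ b →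
      (∀ g → g < n → CycBetween a b g → m g ≡ false) → at ds a ≢ at ds b
    alternating-ℕ a<n b<n ma mb a≢b between eq = alternating (fromℕ< a<n) (fromℕ< b<n)
      (trans (extend-fromℕ< M a<n) ma) (trans (extend-fromℕ< M b<n) mb)
      (λ e → a≢b (trans (sym (toℕ-fromℕ< a<n)) (trans (cong toℕ e) (toℕ-fromℕ< b<n))))
      (λ g btw → trans (sym (extend-toℕ M g))
        (between (toℕ g) (toℕ<n g) (subst₂ (λ a b → CycBetween a b (toℕ g)) (toℕ-fromℕ< a<n) (toℕ-fromℕ< b<n) btw)))
      (trans (lookup-fromℕ< ds a<n) (trans eq (sym (lookup-fromℕ< ds b<n))))

  doubled-parityAlternating : ParityAlternating (at (ds ++ ds)) (m 0) (2 + n)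
  doubled-parityAlternating e q (s≤s (s≤s e<n)) eq with <-cmp (2 + e) n
  ... | tri< 2+e<n _ _ = alternating-ℕ e<n 2+e<n (matched e<n q) (matched 2+e<n (trans (isEven-2+ e) q))
          (<⇒≢ (<-trans (n<1+n e) (n<1+n _))) between
          (trans (sym (at-++ˡ ds ds e<n)) (trans (sym eq) (at-++ˡ ds ds 2+e<n)))
    where
    between : ∀ g → g < n → CycBetween e (2 + e) g → m g ≡ false
    between g _ (inj₁ (_ , e<g , g<2+e)) =
      trans (cong m (between-suc e<g g<2+e)) (trans (matched-flips e (<-trans (n<1+n _) 2+e<n)) (cong not (matched e<n q)))
    between g _ (inj₂ (2+e<e , _)) = ⊥-elim (<-asym 2+e<e (<-trans (n<1+n e) (n<1+n _)))
  ... | tri≈ _ 2+e≡n _ = alternating-ℕ e<n 0<n (matched e<n q) (matched 0<n 0-even) e≢0 between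
          (trans (sym (at-++ˡ ds ds e<n)) (trans (sym eq) (trans (cong (at (ds ++ ds)) (trans 2+e≡n (sym (+-identityʳ n)))) (at-++ʳ ds ds 0))))
    where
    0<n = ≤-trans (s≤s z≤n) 4≤n
    0-even : true ≡ m 0
    0-even = trans (sym n-even) (trans (cong isEven (sym 2+e≡n)) (trans (isEven-2+ e) q))
    e≢0 : e ≢ 0
    e≢0 refl = <-irrefl 2+e≡n (≤-trans (s≤s (s≤s (s≤s z≤n))) 4≤n)
    between : ∀ g → g < n → CycBetween e 0 g → m g ≡ false
    between g _ (inj₁ (() , _))
    between g g<n (inj₂ (_ , inj₁ e<g)) =
      trans (cong m (between-suc e<g (subst (g <_) (sym 2+e≡n) g<n)))
        (trans (matched-flips e (subst (suc e <_) 2+e≡n ≤-refl)) (cong not (matched e<n q)))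
    between g _ (inj₂ (_ , inj₂ ()))
  ... | tri> _ _ n<2+e = alternating-ℕ e<n 1<n (matched e<n q) m1 e≢1 between
          (trans (sym (at-++ˡ ds ds e<n)) (trans (sym eq) (trans (cong (at (ds ++ ds)) (trans (cong suc 1+e≡n) (+-comm 1 n))) (at-++ʳ ds ds 1))))
    where
    1<n = ≤-trans (s≤s (s≤s z≤n)) 4≤n
    1+e≡n : suc e ≡ n
    1+e≡n = ≤-antisym e<n (≤-pred n<2+e)
    0-odd : false ≡ m 0
    0-odd = trans (sym (not-injective (trans (cong isEven 1+e≡n) n-even))) q
    m1 : m 1 ≡ true
    m1 = trans (matched-flips 0 1<n) (cong not (sym 0-odd))
    e≢1 : e ≢ 1
    e≢1 refl = <-irrefl 1+e≡n (≤-trans (s≤s (s≤s (s≤s z≤n))) 4≤n)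
    between : ∀ g → g < n → CycBetween e 1 g → m g ≡ false
    between g _ (inj₁ (e<1 , _)) = ⊥-elim (1+n≰n (≤-trans (≤-trans (s≤s (s≤s z≤n)) 4≤n) (subst (_≤ 1) 1+e≡n e<1)))
    between g g<n (inj₂ (_ , inj₁ e<g)) = ⊥-elim (<⇒≱ e<g (≤-pred (subst (g <_) (sym 1+e≡n) g<n)))
    between zero _ (inj₂ (_ , inj₂ _)) = sym 0-odd
    between (suc g) _ (inj₂ (_ , inj₂ (s≤s ())))

  altMatchingCycle-T2r : IotHom (cycleG ds) T2r
  altMatchingCycle-T2r = closedWalk⇒cycleHom ds (restrict (n≤1+n _) W) (λ i i<n → at-++ˡ ds ds i<n)
    (trans (cong v n≡) (T2rWalk-period4 W k 0 (subst (_≤ 2 + n) n≡ (≤-trans (n≤1+n _) (n≤1+n _)))))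
    (trans (cong v n+1≡) (T2rWalk-period4 W k 1 (subst (_≤ 2 + n) n+1≡ (n≤1+n _))))
    where
    W = parityAlternating⇒T2rWalk doubled-parityAlternating
    v = OrientedWalk.vertex W
    n≡ : n ≡ 4 * k + 0
    n≡ = trans len (sym (+-identityʳ _))
    n+1≡ : suc n ≡ 4 * k + 1
    n+1≡ = trans (cong suc len) (+-comm 1 _)

module _ {D : ℕ → Bool} {t p} (3≤t : 3 ≤ t) (periodic : ∀ i → D (t + i) ≡ D i)
         (alt : ParityAlternating D p (2 + (t + t))) where
  private
    L = 2 + (t + t)

    D-start+ : ∀ j → j ≤ t → D (start p + (j + j)) ≡ (if isEven j then D (start p) else not (D (start p)))
    D-start+ j j≤t = parity-iterate alt j (s≤s (≤-trans (+-monoʳ-≤ (start p) (+-mono-≤ j≤t j≤t)) (+-monoˡ-≤ (t + t) (start≤1 p))))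
      where
      start≤1 : ∀ p → start p ≤ 1
      start≤1 true = z≤n
      start≤1 false = s≤s z≤n

    if-fixed : ∀ b {x} → (if b then x else not x) ≡ x → b ≡ true
    if-fixed true _ = refl
    if-fixed false {x} e = ⊥-elim (⟦⟧-not x (cong ⟦_⟧ e))

  -- Along one parity class the directions alternate, and going once and twice around the cycle must bring
  -- them back to the first one: this forces t ≡ 0 mod 4.
  cycle-length : ∃[ k ] (t ≡ 4 * k × 1 ≤ k)
  cycle-length with isEven t in t-parity
  ... | false = ⊥-elim (true≢false (trans (sym (if-fixed (isEven t) (trans (sym (D-start+ t ≤-refl)) twice))) t-parity))
    where
    twice : D (start p + (t + t)) ≡ D (start p)
    twice = begin
      D (start p + (t + t))   ≡⟨ cong D (trans (+-comm (start p) (t + t)) (+-assoc t t (start p))) ⟩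
      D (t + (t + start p))   ≡⟨ periodic _ ⟩
      D (t + start p)         ≡⟨ periodic _ ⟩
      D (start p)             ∎
      where open ≡-Reasoning
  ... | true with even-form t t-parity
  ...   | h , t≡ with even-form h (if-fixed (isEven h) (trans (sym (D-start+ h h≤t)) once))
    where
    h≤t = subst (h ≤_) (sym t≡) (m≤m+n h h)
    once : D (start p + (h + h)) ≡ D (start p)
    once = trans (cong D (trans (cong (start p +_) (sym t≡)) (+-comm (start p) t))) (periodic _)
  ...     | g , h≡ = g , t≡4g , n≢0⇒n>0 (λ g≡0 → <⇒≱ (subst (2 <_) (trans t≡4g (cong (4 *_) g≡0)) 3≤t) z≤n)
    where
    t≡4g : t ≡ 4 * g
    t≡4g = trans t≡ (trans (cong (λ h → h + h) h≡) (trans (cong₂ _+_ double double) (sym (*-distribʳ-+ g 2 2))))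
      where double = cong (g +_) (sym (+-identityʳ g))

  cycle-altMatching : AltMatchingCycle (applyUpTo D t) (parityClass p)
  cycle-altMatching = matching , saturated , alternating
    where
    ds = applyUpTo D t
    n = length ds
    n≡t : n ≡ t
    n≡t = length-applyUpTo D t
    M = parityClass p
    sel : Selects M p
    sel = parityClass-selects p
    n-even : isEven n ≡ true
    n-even with cycle-length
    ... | k , t≡ , _ = trans (cong isEven (trans n≡t t≡)) (isEven-4* k)
    3≤n : 3 ≤ n
    3≤n = subst (3 ≤_) (sym n≡t) 3≤t
    selectedAt : ∀ {c} (c<n : c < n) → isEven c ≡ p → M (fromℕ< c<n) ≡ true
    selectedAt c<n q = from (sel (fromℕ< c<n)) (trans (cong isEven (toℕ-fromℕ< c<n)) q)
    D-lookup : ∀ e → lookup ds e ≡ D (toℕ e)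
    D-lookup = lookup-applyUpTo D t

    matching : ∀ e f → M e ≡ true → M f ≡ true →
      (toℕ f ≡ suc (toℕ e) ⊎ (suc (toℕ e) ≡ n × toℕ f ≡ 0)) → ⊥
    matching e f Me Mf (inj₁ f≡) = ≡⇒not≢ (to (sel e) Me) (trans (cong isEven (sym f≡)) (to (sel f) Mf))
    matching e f Me Mf (inj₂ (1+e≡n , f≡0)) =
      ≡⇒not≢ (to (sel e) Me) (trans (cong isEven 1+e≡n) (trans n-even (trans (cong isEven (sym f≡0)) (to (sel f) Mf))))

    saturated : ∀ v → ∃[ e ] (M e ≡ true ×
      (toℕ e ≡ toℕ v ⊎ suc (toℕ e) ≡ toℕ v ⊎ (suc (toℕ e) ≡ n × toℕ v ≡ 0)))
    saturated v with isEven (toℕ v) ≟ᵇ p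
    ... | yes q = v , from (sel v) q , inj₁ refl
    ... | no q = previous (toℕ v) refl (toℕ<n v) q
      where
      previous : ∀ w → toℕ v ≡ w → w < n → isEven w ≢ p → ∃[ e ] (M e ≡ true ×
        (toℕ e ≡ toℕ v ⊎ suc (toℕ e) ≡ toℕ v ⊎ (suc (toℕ e) ≡ n × toℕ v ≡ 0)))
      previous (suc u) v≡ w<n q = fromℕ< u<n , selectedAt u<n (not≢⇒≡ q) , inj₂ (inj₁ (trans (cong suc (toℕ-fromℕ< u<n)) (sym v≡)))
        where u<n = <-trans (n<1+n u) w<n
      previous zero v≡ _ q = fromℕ< n-1<n , selectedAt n-1<n last-odd , inj₂ (inj₂ (trans (cong suc (toℕ-fromℕ< n-1<n)) 1+n-1≡n , v≡))
        where
        1+n-1≡n : suc (n ∸ 1) ≡ n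
        1+n-1≡n = m+[n∸m]≡n (≤-trans (s≤s z≤n) 3≤n)
        n-1<n = subst (n ∸ 1 <_) 1+n-1≡n ≤-refl
        last-odd : isEven (n ∸ 1) ≡ p
        last-odd = trans (not-injective (trans (cong isEven 1+n-1≡n) n-even)) (≢⇒not≡ q)

    alternating : ∀ e f → M e ≡ true → M f ≡ true → e ≢ f →
      (∀ g → CycBetween (toℕ e) (toℕ f) (toℕ g) → M g ≡ false) → lookup ds e ≢ lookup ds f
    alternating e f Me Mf e≢f between eq =
      alt a (to (sel e) Me) 2+a<L (trans next-selected (trans (sym (D-lookup f)) (trans (sym eq) (D-lookup e))))
      where
      a = toℕ e
      b = toℕ f
      pa = to (sel e) Me
      pb = to (sel f) Mf
      a<n = toℕ<n e
      b<n = toℕ<n f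
      2+a<L : 2 + a < L
      2+a<L = s≤s (s≤s (≤-trans (subst (a <_) n≡t a<n) (m≤m+n t t)))
      not-between : ∀ c → c < n → isEven c ≡ p → ¬ CycBetween a b c
      not-between c c<n q btw = true≢false (trans (sym (selectedAt c<n q))
        (between (fromℕ< c<n) (subst (CycBetween a b) (sym (toℕ-fromℕ< c<n)) btw)))
      D-wrap : ∀ i → D (n + i) ≡ D i
      D-wrap i = trans (cong (λ m → D (m + i)) n≡t) (periodic i)
      wrap₀ : b < a → 2 + a ≡ n → D (2 + a) ≡ D b
      wrap₀ b<a 2+a≡n with <-cmp 0 b
      ... | tri≈ _ 0≡b _ = trans (cong D (trans 2+a≡n (sym (+-identityʳ n)))) (trans (D-wrap 0) (cong D 0≡b))
      ... | tri< 0<b _ _ = ⊥-elim (not-between 0 (≤-trans (s≤s z≤n) 3≤n)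
              (trans (sym n-even) (trans (cong isEven (sym 2+a≡n)) (trans (isEven-2+ a) pa))) (inj₂ (b<a , inj₂ 0<b)))
      p-odd : suc a ≡ n → false ≡ p
      p-odd 1+a≡n = trans (sym (not-injective (trans (cong isEven 1+a≡n) n-even))) pa
      wrap₁ : b < a → suc a ≡ n → D (2 + a) ≡ D b
      wrap₁ b<a 1+a≡n with <-cmp 1 b
      ... | tri≈ _ 1≡b _ = trans (cong D (trans (cong suc 1+a≡n) (+-comm 1 n))) (trans (D-wrap 1) (cong D 1≡b))
      ... | tri< 1<b _ _ = ⊥-elim (not-between 1 (≤-trans (s≤s (s≤s z≤n)) 3≤n) (p-odd 1+a≡n) (inj₂ (b<a , inj₂ 1<b)))
      ... | tri> _ _ (s≤s b≤0) = ⊥-elim (true≢false (trans (cong isEven (sym (n≤0⇒n≡0 b≤0))) (trans pb (sym (p-odd 1+a≡n)))))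
      next-selected : D (2 + a) ≡ D b
      next-selected with <-cmp a b
      ... | tri≈ _ a≡b _ = ⊥-elim (e≢f (toℕ-injective a≡b))
      ... | tri< a<b _ _ with <-cmp b (2 + a)
      ...   | tri< b<2+a _ _ = ⊥-elim (≡⇒not≢ pa (trans (cong isEven (sym (≤-antisym (≤-pred b<2+a) a<b))) pb))
      ...   | tri≈ _ b≡2+a _ = cong D (sym b≡2+a)
      ...   | tri> _ _ 2+a<b = ⊥-elim (not-between (2 + a) (<-trans 2+a<b b<n) (trans (isEven-2+ a) pa)
                                  (inj₁ (a<b , <-trans (n<1+n a) (n<1+n _) , 2+a<b)))
      next-selected | tri> _ _ b<a with <-cmp (2 + a) n
      ...   | tri< 2+a<n _ _ = ⊥-elim (not-between (2 + a) 2+a<n (trans (isEven-2+ a) pa)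
                                  (inj₂ (b<a , inj₁ (<-trans (n<1+n a) (n<1+n _)))))
      ...   | tri≈ _ 2+a≡n _ = wrap₀ b<a 2+a≡n
      ...   | tri> _ _ n<2+a = wrap₁ b<a (≤-antisym a<n (≤-pred n<2+a))

either : ∀ b → T b ⊎ T (not b)
either true = inj₁ tt
either false = inj₂ tt

star-no-T2r : ∀ b₁ b₂ b₃ → ¬ IotHom (starG b₁ b₂ b₃) T2r
star-no-T2r b₁ b₂ b₃ (f , _ , iot) = distinct (fs (fs fz)) (either b₂) (fs (fs (fs fz))) (either b₃) (λ ())
  (fin2-pigeonhole (distinct (fs fz) (either b₁) (fs (fs fz)) (either b₂) (λ ()))
                   (distinct (fs fz) (either b₁) (fs (fs (fs fz))) (either b₃) (λ ())))
  where
  S = starG b₁ b₂ b₃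
  distinct : ∀ x → Nbr S fz x → ∀ y → Nbr S fz y → x ≢ y → f x ≢ f y
  distinct x nx y ny x≢y e = x≢y (iot fz x y nx ny e)

InP-notParityAlternating : ∀ ds → InP ds → ∀ p → ¬ ParityAlternating (at ds) p (length ds)
InP-notParityAlternating ds (suc (suc j) , s≤s (s≤s z≤n) , len , _ , _ , e₀ , e₁) true alt =
  alt 0 refl (subst (2 <_) (sym (trans len (double-2+ j))) (s≤s (s≤s (s≤s z≤n)))) (sym e₀)
InP-notParityAlternating ds (suc (suc j) , s≤s (s≤s z≤n) , len , _ , _ , e₀ , e₁) false alt =
  alt (suc (j + j)) (cong not (isEven-double j)) (subst (_ <_) (sym (trans len (double-2+ j))) ≤-refl)
    (subst₂ (λ a b → at ds a ≡ at ds b) (cong (_∸ 1) (double-2+ j)) (cong (_∸ 3) (double-2+ j)) e₁)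

forbiddenPath-no-T2r : ∀ ds → InP ds → ¬ IotHom (pathG ds) T2r
forbiddenPath-no-T2r ds inP h with T2rWalk⇒parityAlternating (pathHom⇒walk {T2r} ds h)
... | p , alt = InP-notParityAlternating ds inP p alt

-- Repetitions D (2 + i) ≡ D i and D (2 + s) ≡ D s of both parities with none in between; the arcs i, …, s + 2
-- then form a path of 𝒫 (window⇒forbiddenPath).
record Window (D : ℕ → Bool) (L : ℕ) : Set where
  field
    i s          : ℕ
    i<s          : i < s
    parities     : isEven i ≢ isEven s
    repeat-i     : D (2 + i) ≡ D i
    repeat-s     : D (2 + s) ≡ D s
    2+s<L        : 2 + s < L
    alternating  : ∀ e → i < e → e < s → D (2 + e) ≢ D e

module _ (D : ℕ → Bool) (L : ℕ) where
  private
    Repeat : ℕ → Set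
    Repeat e = 2 + e < L × D (2 + e) ≡ D e

    RepeatOf : Bool → ℕ → Set
    RepeatOf p e = isEven e ≡ p × Repeat e

    repeat? : ∀ e → Dec (Repeat e)
    repeat? e = (suc (suc e) <? L) ×-dec (D (2 + e) ≟ᵇ D e)

    repeatOf? : ∀ p e → Dec (RepeatOf p e)
    repeatOf? p e = (isEven e ≟ᵇ p) ×-dec repeat? e

    -- s is the first repetition of its parity, so the last repetition before s has the other parity.
    window : ∀ {p} a s → a < s → Repeat a → RepeatOf p s → (∀ j → j < s → ¬ RepeatOf p j) → Window D L
    window {p} a s a<s ra (qs , 2+s<L , rs) first with greatest? repeat? s
    ... | inj₂ none = ⊥-elim (none a a<s ra)
    ... | inj₁ (i , i<s , (_ , ri) , last) = record
      { i = i ; s = s ; i<s = i<s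
      ; parities = λ q → first i i<s (trans q qs , proj₁ ri' , ri)
      ; repeat-i = ri ; repeat-s = rs ; 2+s<L = 2+s<L
      ; alternating = λ e i<e e<s eq → last e i<e e<s (<-trans (s≤s (s≤s e<s)) 2+s<L , eq)
      }
      where ri' = (<-trans (s≤s (s≤s i<s)) 2+s<L , ri)

  parityAlternating-or-window : (∃[ p ] ParityAlternating D p L) ⊎ Window D L
  parityAlternating-or-window with least? (repeatOf? true) L | least? (repeatOf? false) L
  ... | inj₂ none | _ = inj₁ (true , λ e q 2+e<L eq → none e (<-trans (n<1+n e) (<-trans (n<1+n _) 2+e<L)) (q , 2+e<L , eq))
  ... | _ | inj₂ none = inj₁ (false , λ e q 2+e<L eq → none e (<-trans (n<1+n e) (<-trans (n<1+n _) 2+e<L)) (q , 2+e<L , eq))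
  ... | inj₁ (a , _ , ra , first-a) | inj₁ (b , _ , rb , first-b) with <-cmp a b
  ...   | tri< a<b _ _ = inj₂ (window a b a<b (proj₂ ra) rb first-b)
  ...   | tri> _ _ b<a = inj₂ (window b a b<a (proj₂ rb) ra first-a)
  ...   | tri≈ _ refl _ = ⊥-elim (true≢false (trans (sym (proj₁ ra)) (proj₁ rb)))

window⇒forbiddenPath : ∀ {H D L} → OrientedWalk H D L → Window D L → ∃[ ds ] (InP ds × IotHom (pathG ds) H)
window⇒forbiddenPath {H} {D} {L} W w with odd-gap (Window.i<s w) (Window.parities w)
... | h , s≡ = applyUpTo E (2 * k) , inP , walk⇒tabulatedPathHom (shift-walk W i i+2k≤L)
  where
  open Window w
  k = 2 + h
  E = D ∘ (i +_)
  2k≡ : 2 * k ≡ 4 + (h + h)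
  2k≡ = double-2+ h
  s+3≡ : i + (4 + (h + h)) ≡ 3 + s
  s+3≡ = trans (+-suc² i _) (cong (suc ∘ suc) (trans (+-suc i _) (cong suc (sym s≡))))
  i+2k≤L : i + 2 * k ≤ L
  i+2k≤L = subst (_≤ L) (sym (trans (cong (i +_) 2k≡) s+3≡)) 2+s<L
  E-at : ∀ {j} → j < 2 * k → at (applyUpTo E (2 * k)) j ≡ E j
  E-at = at-applyUpTo E (2 * k)
  middle : take (2 * k ∸ 2) (drop 1 (applyUpTo E (2 * k))) ≡ applyUpTo (E ∘ suc) (2 + (h + h))
  middle = trans (cong (λ n → take (n ∸ 2) (drop 1 (applyUpTo E n))) 2k≡) (take-applyUpTo (E ∘ suc) (n≤1+n _))
  middle-alternating : ∀ p → ParityAlternating (at (applyUpTo (E ∘ suc) (2 + (h + h)))) p (length (applyUpTo (E ∘ suc) (2 + (h + h))))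
  middle-alternating p t _ 2+t<len eq = alternating (i + suc t) (m<m+n i (s≤s z≤n)) e<s (begin
      D (2 + (i + suc t))       ≡⟨ cong D (+-suc² i (suc t)) ⟨
      E (3 + t)                 ≡⟨ at-applyUpTo (E ∘ suc) _ 2+t<len' ⟨
      at (applyUpTo (E ∘ suc) (2 + (h + h))) (2 + t) ≡⟨ eq ⟩
      at (applyUpTo (E ∘ suc) (2 + (h + h))) t ≡⟨ at-applyUpTo (E ∘ suc) _ (<-trans (n<1+n t) (<-trans (n<1+n _) 2+t<len')) ⟩
      D (i + suc t)             ∎)
    where
    open ≡-Reasoning
    2+t<len' = subst (2 + t <_) (length-applyUpTo (E ∘ suc) _) 2+t<len
    e<s : i + suc t < s
    e<s = subst (i + suc t <_) (sym s≡) (+-monoʳ-< i (s≤s (≤-pred (≤-pred 2+t<len'))))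
  inP : InP (applyUpTo E (2 * k))
  inP = k , s≤s (s≤s z≤n) , length-applyUpTo E (2 * k)
      , subst (λ xs → AltMatchingPath xs (isEven ∘ toℕ)) (sym middle)
          (parityAlternating⇒altMatchingPath _ evens-selects (middle-alternating true))
      , subst (λ xs → AltMatchingPath xs (not ∘ isEven ∘ toℕ)) (sym middle)
          (parityAlternating⇒altMatchingPath _ odds-selects (middle-alternating false))
      , (begin
          at (applyUpTo E (2 * k)) 0   ≡⟨ E-at (subst (0 <_) (sym 2k≡) (s≤s z≤n)) ⟩
          D (i + 0)                    ≡⟨ cong D (+-identityʳ i) ⟩
          D i                          ≡⟨ repeat-i ⟨
          D (2 + i)                    ≡⟨ cong D (+-comm 2 i) ⟩
          D (i + 2)                    ≡⟨ E-at (subst (2 <_) (sym 2k≡) (s≤s (s≤s (s≤s z≤n)))) ⟨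
          at (applyUpTo E (2 * k)) 2   ∎)
      , (begin
          at (applyUpTo E (2 * k)) (2 * k ∸ 1)   ≡⟨ cong (λ n → at (applyUpTo E (2 * k)) (n ∸ 1)) 2k≡ ⟩
          at (applyUpTo E (2 * k)) (3 + (h + h)) ≡⟨ E-at (subst (3 + (h + h) <_) (sym 2k≡) ≤-refl) ⟩
          D (i + (3 + (h + h)))                   ≡⟨ cong D (trans (+-suc² i _) (cong (suc ∘ suc) (sym s≡))) ⟩
          D (2 + s)                               ≡⟨ repeat-s ⟩
          D s                                     ≡⟨ cong D s≡ ⟩
          D (i + (1 + (h + h)))                   ≡⟨ E-at (subst (1 + (h + h) <_) (sym 2k≡) (≤-trans (n≤1+n _) (n≤1+n _))) ⟨
          at (applyUpTo E (2 * k)) (1 + (h + h)) ≡⟨ cong (λ n → at (applyUpTo E (2 * k)) (n ∸ 3)) 2k≡ ⟨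
          at (applyUpTo E (2 * k)) (2 * k ∸ 3)   ∎)
    where open ≡-Reasoning

noForbiddenPath⇒parityAlternating : ∀ {H D L} → (∀ ds → InP ds → ¬ IotHom (pathG ds) H) →
  OrientedWalk H D L → ∃[ p ] ParityAlternating D p L
noForbiddenPath⇒parityAlternating {D = D} {L} noP W with parityAlternating-or-window D L
... | inj₁ alt = alt
... | inj₂ w with window⇒forbiddenPath W w
...   | ds , inP , h = ⊥-elim (noP ds inP h)

nbr-map : ∀ {F G f} → IsHom F G f → ∀ {x y} → Nbr F x y → Nbr G (f x) (f y)
nbr-map hom (inj₁ a) = inj₁ (hom _ _ a)
nbr-map hom (inj₂ a) = inj₂ (hom _ _ a)

iotHom-∘ : ∀ {F G H} → IotHom G H → IotHom F G → IotHom F H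
iotHom-∘ {F} {G} (g , g-hom , g-iot) (f , f-hom , f-iot) =
  g ∘ f , (λ x y a → g-hom _ _ (f-hom x y a)) ,
  (λ x y z ny nz e → f-iot x y z ny nz (g-iot _ _ _ (nbr-map {F} {G} f-hom ny) (nbr-map {F} {G} f-hom nz) e))

conn-trans : ∀ {G x y z} → Conn G x y → Conn G y z → Conn G x z
conn-trans c here = c
conn-trans c (step d n) = step (conn-trans c d) n

conn-sym : ∀ {G x y} → Conn G x y → Conn G y x
conn-sym here = here
conn-sym {G} (step c n) = conn-trans {G} (step here (nbr-sym G n)) (conn-sym {G} c)

conn-map : ∀ {F G f} → IsHom F G f → ∀ {a b} → Conn F a b → Conn G (f a) (f b)
conn-map hom here = here
conn-map {F} {G} hom (step c n) = step (conn-map {F} {G} hom c) (nbr-map {F} {G} hom n)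

star-connected : ∀ b₁ b₂ b₃ i → Conn (starG b₁ b₂ b₃) fz i
star-connected b₁ b₂ b₃ fz = here
star-connected b₁ b₂ b₃ (fs fz) = step here (either b₁)
star-connected b₁ b₂ b₃ (fs (fs fz)) = step here (either b₂)
star-connected b₁ b₂ b₃ (fs (fs (fs fz))) = step here (either b₃)

clamp-toℕ : ∀ L (i : Fin (suc L)) → clamp L (toℕ i) ≡ i
clamp-toℕ L i = toℕ-injective (toℕ-clamp L (≤-pred (toℕ<n i)))

path-connected : ∀ ds i → Conn (pathG ds) fz i
path-connected ds i = subst (Conn (pathG ds) fz) (clamp-toℕ _ i) (from-start (toℕ i) (≤-pred (toℕ<n i)))
  where
  from-start : ∀ j → j ≤ length ds → Conn (pathG ds) fz (clamp (length ds) j)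
  from-start zero _ = here
  from-start (suc j) j< = step (from-start j (≤-trans (n≤1+n j) j<)) (oriented-nbr (pathG ds) (at ds j) (clamp-oriented ds j j<))

LabelledComponent : (T G : Digraph) → Fin (size G) → Set
LabelledComponent T G v = Σ Digraph λ H → ComponentIs G v H × IotHom H T

module _ {G H v} (component : ComponentIs G v H) where
  private
    φ = proj₁ component
    φ-arc = proj₁ (proj₂ (proj₂ component))
    φ-onto = proj₂ (proj₂ (proj₂ (proj₂ component)))

  component-arc : ∀ {i j} → Arc G (φ i) (φ j) → Arc H i j
  component-arc {i} {j} a = from T-≡ (trans (φ-arc i j) (to T-≡ a))

  component-nbr : ∀ {i j} → Nbr G (φ i) (φ j) → Nbr H i j
  component-nbr (inj₁ a) = inj₁ (component-arc a)
  component-nbr (inj₂ a) = inj₂ (component-arc a)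

  into-component : ∀ {F} (h : IotHom F G) → (∀ x → Conn G v (proj₁ h x)) → IotHom F H
  into-component {F} (f , f-hom , f-iot) inside = pre , hom , iot
    where
    pre : Fin (size F) → Fin (size H)
    pre x = proj₁ (φ-onto (f x) (inside x))
    φ-pre : ∀ x → φ (pre x) ≡ f x
    φ-pre x = proj₂ (φ-onto (f x) (inside x))
    hom : IsHom F H pre
    hom x y a = component-arc (subst₂ (Arc G) (sym (φ-pre x)) (sym (φ-pre y)) (f-hom x y a))
    iot : IotInjective F H pre
    iot x y z ny nz e = f-iot x y z ny nz (trans (sym (φ-pre y)) (trans (cong φ e) (φ-pre z)))

-- The homomorphisms of the components are glued at a representative of each component: its first vertex in
-- the enumeration of Fin (size G).
module _ {T G : Digraph} (labelled : ∀ v → LabelledComponent T G v) where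
  private
    n = size G
    H : Fin n → Digraph
    H v = proj₁ (labelled v)
    component : ∀ v → ComponentIs G v (H v)
    component v = proj₁ (proj₂ (labelled v))
    λ[_] : ∀ v → Fin (size (H v)) → Fin (size T)
    λ[ v ] = proj₁ (proj₂ (proj₂ (labelled v)))
    φ : ∀ v → Fin (size (H v)) → Fin n
    φ v = proj₁ (component v)
    φ-onto : ∀ v w → Conn G v w → ∃[ i ] (φ v i ≡ w)
    φ-onto v = proj₂ (proj₂ (proj₂ (proj₂ (component v))))

    connected? : ∀ v w → Dec (Conn G v w)
    connected? v w = map′ (λ (i , e) → subst (Conn G v) e (proj₁ (proj₂ (proj₂ (proj₂ (component v)))) i))
                          (φ-onto v w) (any? (λ i → φ v i ≟ᶠ w))

    rep : Fin n → Fin n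
    rep y = fromMaybe y (head (filter (connected? y) (allFin n)))

    rep-connected : ∀ y → Conn G y (rep y)
    rep-connected y with filter (connected? y) (allFin n) in eq
    ... | [] = here
    ... | w ∷ _ = proj₂ (∈-filter⁻ (connected? y) {xs = allFin n} (subst (w ∈_) (sym eq) (here refl)))

    rep-component : ∀ {y z} → Conn G y z → rep y ≡ rep z
    rep-component {y} {z} c with filter-≐ (connected? y) (connected? z)
           ((λ c' → conn-trans (conn-sym c) c') , (λ c' → conn-trans c c')) (allFin n)
    ... | same-members = trans (cong (fromMaybe y ∘ head) same-members) (first-member (∈-filter⁺ (connected? z) (∈-allFin z) here))
      where
      first-member : ∀ {ws} → z ∈ ws → fromMaybe y (head ws) ≡ fromMaybe z (head ws)
      first-member (here _) = refl
      first-member (there _) = refl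

    index : ∀ r w → Conn G r w → Fin (size (H r))
    index r w c = proj₁ (φ-onto r w c)

    φ-index : ∀ r w c → φ r (index r w c) ≡ w
    φ-index r w c = proj₂ (φ-onto r w c)

    index-irrelevant : ∀ r w c c' → index r w c ≡ index r w c'
    index-irrelevant r w c c' = proj₁ (proj₂ (component r)) (trans (φ-index r w c) (sym (φ-index r w c')))

    label : Fin n → Fin (size T)
    label y = λ[ rep y ] (index (rep y) y (conn-sym (rep-connected y)))

    label-at : ∀ {z r} → rep z ≡ r → (c : Conn G r z) → label z ≡ λ[ r ] (index r z c)
    label-at refl c = cong λ[ _ ] (index-irrelevant _ _ _ c)

    hom : IsHom G T label
    hom y z a = subst (Arc T (label y)) (sym (label-at (sym (rep-component (step here (inj₁ a)))) c-z))
      (proj₁ (proj₂ (proj₂ (proj₂ (labelled r)))) _ _ (component-arc (component r) (subst₂ (Arc G) (sym (φ-index r y c-y)) (sym (φ-index r z c-z)) a)))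
      where
      r = rep y
      c-y = conn-sym (rep-connected y)
      c-z = step c-y (inj₁ a)

    iot : IotInjective G T label
    iot x y z ny nz e = trans (sym (φ-index r y c-y)) (trans (cong (φ r) same-index) (φ-index r z c-z))
      where
      r = rep x
      c-x = conn-sym (rep-connected x)
      c-y = step c-x ny
      c-z = step c-x nz
      nbr : ∀ {w} c → Nbr G x w → Nbr (H r) (index r x c-x) (index r w c)
      nbr c nw = component-nbr (component r) (subst₂ (Nbr G) (sym (φ-index r x c-x)) (sym (φ-index r _ c)) nw)
      same-index : index r y c-y ≡ index r z c-z
      same-index = proj₂ (proj₂ (proj₂ (proj₂ (labelled r)))) _ _ _ (nbr c-y ny) (nbr c-z nz)
        (trans (sym (label-at (sym (rep-component (step here ny))) c-y)) (trans e (label-at (sym (rep-component (step here nz))) c-z)))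

  componentwise-iotHom : IotHom G T
  componentwise-iotHom = label , hom , iot

cond3-labelled : ∀ {G} → Cond3 G → ∀ v → LabelledComponent T2r G v
cond3-labelled c3 v with c3 v
... | inj₁ (ds , short , ci) = pathG ds , ci , parityAlternating-pathHom {ds} (short-parityAlternating ds short)
... | inj₂ (inj₁ (ds , (M , am) , ci)) = pathG ds , ci , parityAlternating-pathHom {ds} (proj₂ (altMatchingPath⇒parityAlternating {ds} am))
... | inj₂ (inj₂ (k , ds , 1≤k , len , (M , am) , ci)) = cycleG ds , ci , altMatchingCycle-T2r {ds} am len 1≤k

cond1⇒cond2 : ∀ {G} → Cond1 G → Cond2 G
cond1⇒cond2 {G} c1 = (λ b₁ b₂ b₃ h → star-no-T2r b₁ b₂ b₃ (iotHom-∘ {starG b₁ b₂ b₃} {G} {T2r} c1 h))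
                   , (λ ds inP h → forbiddenPath-no-T2r ds inP (iotHom-∘ {pathG ds} {G} {T2r} c1 h))

cond3⇒cond1 : ∀ {G} → Cond3 G → Cond1 G
cond3⇒cond1 c3 = componentwise-iotHom {T2r} (cond3-labelled c3)

connected-T2r : ∀ {G F} → Cond3 G → ∀ r → (∀ i → Conn F r i) → IotHom F G → IotHom F T2r
connected-T2r {G} {F} c3 r connected h@(f , f-hom , _) with cond3-labelled c3 (f r)
... | H , component , λH = iotHom-∘ {F} {H} {T2r} λH (into-component component h (λ x → conn-map {F} {G} f-hom (connected x)))

cond3⇒cond2 : ∀ {G} → Cond3 G → Cond2 G
cond3⇒cond2 c3 = (λ b₁ b₂ b₃ h → star-no-T2r b₁ b₂ b₃ (connected-T2r c3 fz (star-connected b₁ b₂ b₃) h))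
               , (λ ds inP h → forbiddenPath-no-T2r ds inP (connected-T2r c3 fz (path-connected ds) h))

leaves-nonadjacent : ∀ {b₁ b₂ b₃} i j → starArc b₁ b₂ b₃ (fs i) (fs j) ≡ false
leaves-nonadjacent fz fz = refl
leaves-nonadjacent fz (fs fz) = refl
leaves-nonadjacent fz (fs (fs fz)) = refl
leaves-nonadjacent (fs fz) fz = refl
leaves-nonadjacent (fs fz) (fs fz) = refl
leaves-nonadjacent (fs fz) (fs (fs fz)) = refl
leaves-nonadjacent (fs (fs fz)) fz = refl
leaves-nonadjacent (fs (fs fz)) (fs fz) = refl
leaves-nonadjacent (fs (fs fz)) (fs (fs fz)) = refl

leaf-nbr : ∀ {b₁ b₂ b₃} i {y} → Nbr (starG b₁ b₂ b₃) (fs i) y → y ≡ fz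
leaf-nbr i {fz} _ = refl
leaf-nbr i {fs j} (inj₁ a) = ⊥-elim (subst T (leaves-nonadjacent i j) a)
leaf-nbr i {fs j} (inj₂ a) = ⊥-elim (subst T (leaves-nonadjacent j i) a)

star-into : ∀ {G x} (ℓ : Fin 3 → Fin (size G)) → (∀ i → Nbr G x (ℓ i)) → Injective _≡_ _≡_ ℓ →
  IotHom (starG (arc G x (ℓ fz)) (arc G x (ℓ (fs fz))) (arc G x (ℓ (fs (fs fz))))) G
star-into {G} {x} ℓ nbr ℓ-injective = f , hom , iot
  where
  S = starG (arc G x (ℓ fz)) (arc G x (ℓ (fs fz))) (arc G x (ℓ (fs (fs fz))))
  f : Fin 4 → Fin (size G)
  f fz = x
  f (fs i) = ℓ i
  inward : ∀ i → T (not (arc G x (ℓ i))) → Arc G (ℓ i) x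
  inward i a = nbr-reverse {G} (nbr i) (to T-not-≡ a)
  hom : IsHom S G f
  hom fz (fs fz) a = a
  hom fz (fs (fs fz)) a = a
  hom fz (fs (fs (fs fz))) a = a
  hom (fs fz) fz a = inward fz a
  hom (fs (fs fz)) fz a = inward (fs fz) a
  hom (fs (fs (fs fz))) fz a = inward (fs (fs fz)) a
  hom (fs i) (fs j) a = ⊥-elim (subst T (leaves-nonadjacent i j) a)
  iot : IotInjective S G f
  iot fz (fs i) (fs j) _ _ e = cong fs (ℓ-injective e)
  iot fz fz _ (inj₁ ()) _ _
  iot fz fz _ (inj₂ ()) _ _
  iot fz (fs _) fz _ (inj₁ ()) _
  iot fz (fs _) fz _ (inj₂ ()) _
  iot (fs i) y z ny nz _ = trans (leaf-nbr i ny) (sym (leaf-nbr i nz))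

two-neighbours-exhaust : ∀ {G} → (∀ b₁ b₂ b₃ → ¬ IotHom (starG b₁ b₂ b₃) G) →
  ∀ {x a b c} → Nbr G x a → Nbr G x b → a ≢ b → Nbr G x c → c ≡ a ⊎ c ≡ b
two-neighbours-exhaust {G} noStar {x} {a} {b} {c} na nb a≢b nc with c ≟ᶠ a | c ≟ᶠ b
... | yes c≡a | _ = inj₁ c≡a
... | no _ | yes c≡b = inj₂ c≡b
... | no c≢a | no c≢b = ⊥-elim (noStar _ _ _ (star-into {G} ℓ nbr ℓ-injective))
  where
  ℓ : Fin 3 → Fin (size G)
  ℓ fz = a
  ℓ (fs fz) = b
  ℓ (fs (fs fz)) = c
  nbr : ∀ i → Nbr G x (ℓ i)
  nbr fz = na
  nbr (fs fz) = nb
  nbr (fs (fs fz)) = nc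
  ℓ-injective : Injective _≡_ _≡_ ℓ
  ℓ-injective {fz} {fz} _ = refl
  ℓ-injective {fz} {fs fz} e = ⊥-elim (a≢b e)
  ℓ-injective {fz} {fs (fs fz)} e = ⊥-elim (c≢a (sym e))
  ℓ-injective {fs fz} {fz} e = ⊥-elim (a≢b (sym e))
  ℓ-injective {fs fz} {fs fz} _ = refl
  ℓ-injective {fs fz} {fs (fs fz)} e = ⊥-elim (c≢b (sym e))
  ℓ-injective {fs (fs fz)} {fz} e = ⊥-elim (c≢a e)
  ℓ-injective {fs (fs fz)} {fs fz} e = ⊥-elim (c≢b e)
  ℓ-injective {fs (fs fz)} {fs (fs fz)} _ = refl

module Walking {G : Digraph} (loopless : ∀ x → ¬ Nbr G x x)
  (exhaust : ∀ {x a b c} → Nbr G x a → Nbr G x b → a ≢ b → Nbr G x c → c ≡ a ⊎ c ≡ b) where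

  V = Fin (size G)

  Continuation : V → V → Set
  Continuation p c = ∃[ y ] (Nbr G c y × y ≢ p)

  continuation? : ∀ p c → Dec (Continuation p c)
  continuation? p c = any? (λ y → (T? (arc G c y) ⊎-dec T? (arc G y c)) ×-dec ¬? (y ≟ᶠ p))

  -- A state is the previous vertex and the current one; at the start both are the starting vertex.
  advance : V × V → V × V
  advance (p , c) with continuation? p c
  ... | yes (y , _) = c , y
  ... | no _ = p , c

  state : V → ℕ → V × V
  state v zero = v , v
  state v (suc i) = advance (state v i)

  previous position : V → ℕ → V
  previous v i = proj₁ (state v i)
  position v i = proj₂ (state v i)

  record Moves (v : V) (i : ℕ) : Set where
    constructor moving
    field continuation : Continuation (previous v i) (position v i)

  moves : ∀ {v i} → Moves v i →
    previous v (suc i) ≡ position v i × Nbr G (position v i) (position v (suc i)) × position v (suc i) ≢ previous v i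
  moves {v} {i} (moving m) with continuation? (previous v i) (position v i)
  ... | yes (_ , ny , y≢p) = refl , ny , y≢p
  ... | no ¬m = ⊥-elim (¬m m)

  step-nbr : ∀ {v i} → Moves v i → Nbr G (position v i) (position v (suc i))
  step-nbr m = proj₁ (proj₂ (moves m))

  no-return : ∀ {v i} → Moves v i → Moves v (suc i) → position v (2 + i) ≢ position v i
  no-return {v} {i} m m' = subst (position v (2 + i) ≢_) (proj₁ (moves m)) (proj₂ (proj₂ (moves m')))

  stuck : ∀ {v i y} → ¬ Moves v i → Nbr G (position v i) y → y ≡ previous v i
  stuck {v} {i} {y} ¬m ny with y ≟ᶠ previous v i
  ... | yes y≡p = y≡p
  ... | no y≢p = ⊥-elim (¬m (moving (y , ny , y≢p)))

  walk-connected : ∀ {v j} → (∀ i → i < j → Moves v i) → Conn G v (position v j)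
  walk-connected {v} {zero} _ = here
  walk-connected {v} {suc j} ms = step (walk-connected (λ i i<j → ms i (m<n⇒m<1+n i<j))) (step-nbr (ms j ≤-refl))

  moves? : ∀ v i → Dec (Moves v i)
  moves? v i with continuation? (previous v i) (position v i)
  ... | yes m = yes (moving m)
  ... | no ¬m = no (λ (moving m) → ¬m m)

  -- Until it returns to its start the walk never repeats a vertex: a repetition would be a loop, a
  -- backtrack or a third neighbour of an inner vertex.
  distinct : ∀ {v j} → (∀ i → i < j → Moves v i) → (∀ i → 0 < i → i ≤ j → position v i ≢ v) →
    ∀ {a b} → a < b → b ≤ j → position v a ≢ position v b
  distinct {v} {zero} _ _ a<b b≤0 = ⊥-elim (n≮0 (≤-trans a<b b≤0))
  distinct {v} {suc j} ms away {a} {b} a<b b≤1+j =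
    [ (λ b<1+j → IH a<b (≤-pred b<1+j)) , (λ { refl → new a (≤-pred a<b) }) ] (m≤n⇒m<n∨m≡n b≤1+j)
    where
    ω = position v
    IH = distinct {v} {j} (λ i i<j → ms i (m<n⇒m<1+n i<j)) (λ i 0<i i≤j → away i 0<i (m≤n⇒m≤1+n i≤j))
    new : ∀ a → a ≤ j → ω a ≢ ω (suc j)
    new zero _ eq = away (suc j) (s≤s z≤n) ≤-refl (sym eq)
    new (suc a) 1+a≤j eq with m≤n⇒m<n∨m≡n 1+a≤j
    ... | inj₂ refl = loopless (ω (suc a)) (subst (Nbr G (ω (suc a))) (sym eq) (step-nbr (ms (suc a) ≤-refl)))
    ... | inj₁ 1+a<j with m≤n⇒m<n∨m≡n 1+a<j
    ...   | inj₂ refl = no-return (ms (suc a) (<-trans (n<1+n _) ≤-refl)) (ms (2 + a) ≤-refl) (sym eq)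
    ...   | inj₁ 2+a<j with exhaust (nbr-sym G (step-nbr (ms a a<1+j))) (step-nbr (ms (suc a) 1+a<1+j))
                                     (IH (<-trans (n<1+n a) (n<1+n _)) (<⇒≤ 2+a<j))
                                     (subst (λ x → Nbr G x (ω j)) (sym eq) (nbr-sym G (step-nbr (ms j ≤-refl))))
      where
      1+a<1+j = <-trans 1+a<j (n<1+n j)
      a<1+j = <-trans (n<1+n a) 1+a<1+j
    ...     | inj₁ j≡a = IH (<-trans (n<1+n a) 1+a<j) ≤-refl (sym j≡a)
    ...     | inj₂ j≡2+a = IH 2+a<j ≤-refl (sym j≡2+a)

  data Trail (v : V) : Set where
    cycle : ∀ t → 3 ≤ t → position v t ≡ v → (∀ i → i < t → Moves v i) →
            (∀ i → 0 < i → i < t → position v i ≢ v) → Trail v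
    path  : ∀ t → ¬ Moves v t → (∀ i → i < t → Moves v i) →
            (∀ i → 0 < i → i ≤ t → position v i ≢ v) → Trail v

  private
    Stops : V → ℕ → Set
    Stops v i = ¬ Moves v i ⊎ (0 < i × position v i ≡ v)

    stops? : ∀ v i → Dec (Stops v i)
    stops? v i = ¬? (moves? v i) ⊎-dec ((0 <? i) ×-dec (position v i ≟ᶠ v))

    moving-before : ∀ {v t} → (∀ i → i < t → ¬ Stops v i) → ∀ i → i < t → Moves v i
    moving-before {v} before i i<t = decidable-stable (moves? v i) (λ ¬m → before i i<t (inj₁ ¬m))

    away-before : ∀ {v t} → (∀ i → i < t → ¬ Stops v i) → ∀ i → 0 < i → i < t → position v i ≢ v
    away-before before i 0<i i<t back = before i i<t (inj₂ (0<i , back))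

    three : ∀ {v t} → 0 < t → position v t ≡ v → (∀ i → i < t → Moves v i) → 3 ≤ t
    three {v} {suc zero} _ back ms = ⊥-elim (loopless v (subst (Nbr G v) back (step-nbr (ms 0 ≤-refl))))
    three {v} {suc (suc zero)} _ back ms = ⊥-elim (no-return (ms 0 (s≤s z≤n)) (ms 1 ≤-refl) back)
    three {v} {suc (suc (suc t))} _ _ _ = s≤s (s≤s (s≤s z≤n))

    first-stop : ∀ {v} t → Stops v t → (∀ i → i < t → ¬ Stops v i) → Trail v
    first-stop {v} t stops-t before with (0 <? t) ×-dec (position v t ≟ᶠ v)
    ... | yes (0<t , back) = cycle t (three 0<t back (moving-before before)) back (moving-before before) (away-before before)
    ... | no ¬back = path t not-moving (moving-before before) away
      where
      not-moving : ¬ Moves v t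
      not-moving = [ (λ ¬m → ¬m) , (λ back → ⊥-elim (¬back back)) ] stops-t
      away : ∀ i → 0 < i → i ≤ t → position v i ≢ v
      away i 0<i i≤t with m≤n⇒m<n∨m≡n i≤t
      ... | inj₁ i<t = away-before before i 0<i i<t
      ... | inj₂ refl = λ back → ¬back (0<i , back)

  -- The walk stops moving or returns to its start within size G steps, by the pigeonhole principle.
  trail : ∀ v → Trail v
  trail v with least? (stops? v) (suc (size G))
  ... | inj₁ (t , _ , stops-t , before) = first-stop t stops-t before
  ... | inj₂ never with pigeonhole ≤-refl (position v ∘ toℕ)
  ...   | i , j , i<j , eq = ⊥-elim (distinct {v} {size G}
      (moving-before (λ k k<n → never k (m<n⇒m<1+n k<n))) (λ k 0<k k≤n back → never k (s≤s k≤n) (inj₂ (0<k , back)))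
      i<j (≤-pred (toℕ<n j)) eq)

module Charts {G : Digraph} (io : IrreflexiveOriented G) (ω : ℕ → Fin (size G)) (t : ℕ)
  (steps : ∀ i → i < t → Nbr G (ω i) (ω (suc i))) where

  D : ℕ → Bool
  D i = arc G (ω i) (ω (suc i))

  ds : List Bool
  ds = applyUpTo D t

  len : length ds ≡ t
  len = length-applyUpTo D t

  private
    at-ds : ∀ {i} → i < t → at ds i ≡ D i
    at-ds = at-applyUpTo D t

    <len : ∀ {i} → i < t → i < length ds
    <len = subst (_ <_) (sym len)

    antisymmetric : ∀ {x y} → arc G x y ≡ true → arc G y x ≡ false
    antisymmetric {x} {y} xy with arc G y x in yx
    ... | true = ⊥-elim (proj₂ io x y (from T-≡ xy) (from T-≡ yx))
    ... | false = refl

  pathArc-arc : ∀ {a b} → PathArc ds a b → arc G (ω a) (ω b) ≡ true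
  pathArc-arc (forward i< d) = trans (sym (at-ds (subst (_ <_) len i<))) d
  pathArc-arc (backward i< d) = to T-≡ (nbr-reverse {G} (steps _ i<t) (trans (sym (at-ds i<t)) d))
    where i<t = subst (_ <_) len i<

  arc-forward : ∀ {a} → a < t → arc G (ω a) (ω (suc a)) ≡ true → pArc ds a (suc a) ≡ true
  arc-forward a<t e = trans (pArc-forward ds _ (<len a<t)) (trans (at-ds a<t) e)

  arc-backward : ∀ {b} → b < t → arc G (ω (suc b)) (ω b) ≡ true → pArc ds (suc b) b ≡ true
  arc-backward b<t e = trans (pArc-backward ds _ (<len b<t)) (cong not (trans (at-ds b<t) (antisymmetric e)))

  walk-conn : ∀ {i} → i ≤ t → Conn G (ω 0) (ω i)
  walk-conn {zero} _ = here
  walk-conn {suc i} i<t = step (walk-conn (<⇒≤ i<t)) (steps i i<t)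

  path-chart : ∀ {v} →
    (∀ {a b} → a ≤ t → b ≤ t → ω a ≡ ω b → a ≡ b) →
    (∀ {i y} → i ≤ t → Nbr G (ω i) y → ∃[ j ] (ω j ≡ y × Adjacent t i j)) →
    Conn G v (ω 0) → ComponentIs G v (pathG ds)
  path-chart {v} injective closed start = φ , φ-injective , arcs , (λ x → conn-trans {G} start (walk-conn (bound x))) , onto
    where
    φ : Fin (suc (length ds)) → Fin (size G)
    φ = ω ∘ toℕ
    bound : ∀ (x : Fin (suc (length ds))) → toℕ x ≤ t
    bound x = subst (toℕ x ≤_) len (≤-pred (toℕ<n x))
    adjacent-bound : ∀ {i j} → Adjacent t i j → j ≤ t
    adjacent-bound (right i<t) = i<t
    adjacent-bound (left i<t) = <⇒≤ i<t
    φ-injective : ∀ {x y} → φ x ≡ φ y → x ≡ y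
    φ-injective {x} {y} e = toℕ-injective (injective (bound x) (bound y) e)
    adjacent-pArc : ∀ {a b} → Adjacent t a b → arc G (ω a) (ω b) ≡ true → pArc ds a b ≡ true
    adjacent-pArc (right a<t) = arc-forward a<t
    adjacent-pArc (left b<t) = arc-backward b<t
    arcs : ∀ x y → arc (pathG ds) x y ≡ arc G (φ x) (φ y)
    arcs x y = bool-ext (pathArc-arc ∘ pArc-true ds) backwards
      where
      backwards : arc G (φ x) (φ y) ≡ true → pArc ds (toℕ x) (toℕ y) ≡ true
      backwards e with closed (bound x) (inj₁ (from T-≡ e))
      ... | j , ωj≡ , adj = adjacent-pArc (subst (Adjacent t (toℕ x)) (injective (adjacent-bound adj) (bound y) ωj≡) adj) e
    reach : ∀ {y} → Conn G (ω 0) y → ∃[ j ] (j ≤ t × ω j ≡ y)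
    reach here = 0 , z≤n , refl
    reach (step c n) with reach c
    ... | j , j≤t , refl with closed j≤t n
    ...   | k , ωk≡ , adj = k , adjacent-bound adj , ωk≡
    onto : ∀ y → Conn G v y → ∃[ x ] (φ x ≡ y)
    onto y c with reach (conn-trans {G} (conn-sym {G} start) c)
    ... | j , j≤t , ωj≡ = fromℕ< j<1+len , trans (cong ω (toℕ-fromℕ< j<1+len)) ωj≡
      where j<1+len = s≤s (subst (j ≤_) (sym len) j≤t)

  cycle-chart : ∀ {v} → 0 < t → ω t ≡ ω 0 →
    (∀ {a b} → a < t → b < t → ω a ≡ ω b → a ≡ b) →
    (∀ {i y} → i < t → Nbr G (ω i) y → ∃[ j ] (j < t × ω j ≡ y × (CycleStep t i j ⊎ CycleStep t j i))) →
    Conn G v (ω 0) → ComponentIs G v (cycleG ds)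
  cycle-chart {v} 0<t closes injective closed start =
    φ , φ-injective , arcs , (λ x → conn-trans {G} start (walk-conn (<⇒≤ (bound x)))) , onto
    where
    φ : Fin (length ds) → Fin (size G)
    φ = ω ∘ toℕ
    bound : ∀ (x : Fin (length ds)) → toℕ x < t
    bound x = subst (toℕ x <_) len (toℕ<n x)
    φ-injective : ∀ {x y} → φ x ≡ φ y → x ≡ y
    φ-injective {x} {y} e = toℕ-injective (injective (bound x) (bound y) e)
    lifted : ∀ {a a'} → Lift (length ds) a a' → ω a' ≡ ω a
    lifted same = refl
    lifted top = trans (cong ω len) closes
    wrap-len : ∀ {a} → suc a ≡ t → wrap ds 0 ≡ suc a
    wrap-len 1+a≡t = trans len (sym 1+a≡t)
    ω-close : ∀ {a} → suc a ≡ t → ω (suc a) ≡ ω 0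
    ω-close 1+a≡t = trans (cong ω 1+a≡t) closes
    step-cArc : ∀ {a b} → CycleStep t a b ⊎ CycleStep t b a → arc G (ω a) (ω b) ≡ true → cArc ds a b ≡ true
    step-cArc (inj₁ (step 1+a<t)) e = ∨-introˡ _ (arc-forward (<-trans (n<1+n _) 1+a<t) e)
    step-cArc (inj₂ (step 1+b<t)) e = ∨-introˡ _ (arc-backward (<-trans (n<1+n _) 1+b<t) e)
    step-cArc {a} (inj₁ (close 1+a≡t)) e = ∨-introʳ (pArc ds a 0) (∨-introʳ (pArc ds (wrap ds a) 0)
      (subst (λ m → pArc ds a m ≡ true) (sym (wrap-len 1+a≡t))
        (arc-forward (subst (a <_) 1+a≡t ≤-refl) (trans (cong (arc G (ω a)) (ω-close 1+a≡t)) e))))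
    step-cArc {b = b} (inj₂ (close 1+b≡t)) e = ∨-introʳ (pArc ds 0 b) (∨-introˡ (pArc ds 0 (wrap ds b))
      (subst (λ m → pArc ds m b ≡ true) (sym (wrap-len 1+b≡t))
        (arc-backward (subst (b <_) 1+b≡t ≤-refl) (trans (cong (λ x → arc G x (ω b)) (ω-close 1+b≡t)) e))))
    arcs : ∀ x y → arc (cycleG ds) x y ≡ arc G (φ x) (φ y)
    arcs x y = bool-ext forwards backwards
      where
      forwards : cArc ds (toℕ x) (toℕ y) ≡ true → arc G (φ x) (φ y) ≡ true
      forwards e with cArc-true ds e
      ... | _ , _ , lx , ly , pa = subst₂ (λ a b → arc G a b ≡ true) (lifted lx) (lifted ly) (pathArc-arc pa)
      backwards : arc G (φ x) (φ y) ≡ true → cArc ds (toℕ x) (toℕ y) ≡ true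
      backwards e with closed (bound x) (inj₁ (from T-≡ e))
      ... | j , j<t , ωj≡ , adj = step-cArc (subst (λ b → CycleStep t (toℕ x) b ⊎ CycleStep t b (toℕ x)) (injective j<t (bound y) ωj≡) adj) e
    reach : ∀ {y} → Conn G (ω 0) y → ∃[ j ] (j < t × ω j ≡ y)
    reach here = 0 , 0<t , refl
    reach (step c n) with reach c
    ... | j , j<t , refl with closed j<t n
    ...   | k , k<t , ωk≡ , _ = k , k<t , ωk≡
    onto : ∀ y → Conn G v y → ∃[ x ] (φ x ≡ y)
    onto y c with reach (conn-trans {G} (conn-sym {G} start) c)
    ... | j , j<t , ωj≡ = fromℕ< j<len , trans (cong ω (toℕ-fromℕ< j<len)) ωj≡
      where j<len = subst (j <_) (sym len) j<t

module _ {G : Digraph} (io : IrreflexiveOriented G) (c2 : Cond2 G) where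
  private
    loopless : ∀ x → ¬ Nbr G x x
    loopless x (inj₁ a) = subst T (proj₁ io x) a
    loopless x (inj₂ a) = subst T (proj₁ io x) a

    exhaust : ∀ {x a b c} → Nbr G x a → Nbr G x b → a ≢ b → Nbr G x c → c ≡ a ⊎ c ≡ b
    exhaust = two-neighbours-exhaust {G} (proj₁ c2)

  open Walking {G} loopless exhaust

  private
    noP = proj₂ c2

    walk-oriented : ∀ {v L} → (∀ i → i < L → Moves v i) →
      OrientedWalk G (λ i → arc G (position v i) (position v (suc i))) L
    walk-oriented ms = record
      { vertex = position _
      ; oriented = λ i i<L → nbr-oriented {G} (step-nbr (ms i i<L))
      ; nonbacktracking = λ i 2+i≤L → no-return (ms i (≤-trans (n≤1+n _) 2+i≤L)) (ms (suc i) 2+i≤L)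
      }

    stuck-end : ∀ {u t y} → ¬ Moves u t → (∀ i → i < t → Moves u i) → Nbr G (position u t) y →
      ∃[ j ] (position u j ≡ y × Adjacent t t j)
    stuck-end {u} {zero} ¬m _ ny = ⊥-elim (loopless u (subst (Nbr G u) (stuck ¬m ny) ny))
    stuck-end {u} {suc s} ¬m ms ny = s , sym (trans (stuck ¬m ny) (proj₁ (moves (ms s ≤-refl)))) , left ≤-refl

    -- A walk that gets stuck has reached an end of a path component; walking back from there traverses it.
    path-component : ∀ v t → ¬ Moves v t → (∀ i → i < t → Moves v i) →
      ∃[ ds ] ((∃[ M ] AltMatchingPath ds M) × ComponentIs G v (pathG ds))
    path-component v t ¬m ms with trail (position v t)
    ... | cycle (suc s) (s≤s 2≤s) back ms' away' = ⊥-elim (distinct {u} {s} (λ i i<s → ms' i (m<n⇒m<1+n i<s))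
            (λ i 0<i i≤s → away' i 0<i (s≤s i≤s)) 2≤s ≤-refl
            (trans (end (step-nbr (ms' 0 (s≤s z≤n)))) (sym (end (subst (λ x → Nbr G x (position u s)) back (nbr-sym G (step-nbr (ms' s ≤-refl))))))))
      where
      u = position v t
      end : ∀ {y} → Nbr G u y → y ≡ previous v t
      end = stuck ¬m
    ... | path t' ¬m' ms' away' = applyUpTo D t' , (parityClass p , parityAlternating⇒altMatchingPath ds (parityClass-selects p) alternating)
                                , path-chart (injective-upTo (position u) (distinct ms' away')) closed (walk-connected ms)
      where
      u = position v t
      end : ∀ {y} → Nbr G u y → y ≡ previous v t
      end = stuck ¬m
      open Charts io (position u) t' (λ i i<t' → step-nbr (ms' i i<t'))
      p-alternating = noForbiddenPath⇒parityAlternating noP (tabulate-walk (walk-oriented ms'))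
      p = proj₁ p-alternating
      alternating = proj₂ p-alternating
      closed : ∀ {i y} → i ≤ t' → Nbr G (position u i) y → ∃[ j ] (position u j ≡ y × Adjacent t' i j)
      closed {i} {y} i≤t' ny with m≤n⇒m<n∨m≡n i≤t'
      closed {i} {y} i≤t' ny | inj₂ refl = stuck-end ¬m' ms' ny
      closed {zero} {y} _ ny | inj₁ 0<t' = 1 , trans (end (step-nbr (ms' 0 0<t'))) (sym (end ny)) , right 0<t'
      closed {suc i} {y} _ ny | inj₁ i<t' with exhaust
               (nbr-sym G (step-nbr (ms' i (<-trans (n<1+n i) i<t')))) (step-nbr (ms' (suc i) i<t'))
               (≢-sym (no-return (ms' i (<-trans (n<1+n i) i<t')) (ms' (suc i) i<t'))) ny
      ... | inj₁ y≡ = i , sym y≡ , left (<-trans (n<1+n i) i<t')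
      ... | inj₂ y≡ = 2 + i , sym y≡ , right i<t'

    -- A walk returning to its start goes around a cycle component, and keeps going around it.
    module OnCycle (v : V) (s : ℕ) (3≤t : 3 ≤ suc s) (back : position v (suc s) ≡ v)
      (ms : ∀ i → i < suc s → Moves v i) (away : ∀ i → 0 < i → i < suc s → position v i ≢ v) where
      t = suc s
      ω = position v
      open Charts io ω t (λ i i<t → step-nbr (ms i i<t))
      1<s : 1 < s
      1<s = ≤-pred 3≤t
      last : Nbr G v (ω s)
      last = nbr-sym G (subst (Nbr G (ω s)) back (step-nbr (ms s ≤-refl)))
      first : Nbr G v (ω 1)
      first = step-nbr (ms 0 (s≤s z≤n))
      distinct-before : ∀ {a b} → a < b → b ≤ s → ω a ≢ ω b
      distinct-before = distinct {v} {s} (λ i i<s → ms i (m<n⇒m<1+n i<s)) (λ i 0<i i≤s → away i 0<i (s≤s i≤s))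
      injective : ∀ {a b} → a ≤ s → b ≤ s → ω a ≡ ω b → a ≡ b
      injective = injective-upTo ω distinct-before
      first≢last : ω 1 ≢ ω s
      first≢last = distinct-before 1<s ≤-refl
      moves-t : Moves v t
      moves-t = moving (ω 1 , subst (λ x → Nbr G x (ω 1)) (sym back) first
                             , subst (ω 1 ≢_) (sym (proj₁ (moves (ms s ≤-refl)))) first≢last)
      around : state v (suc t) ≡ state v 1
      around with moves moves-t
      ... | prev≡ , nbr , ≢prev = cong₂ _,_ (trans prev≡ (trans back (sym (proj₁ (moves (ms 0 (s≤s z≤n)))))))
            ([ (λ e → e) , (λ e → ⊥-elim (≢prev (trans e (sym (proj₁ (moves (ms s ≤-refl))))))) ]
               (exhaust first last first≢last (subst (λ x → Nbr G x (position v (suc t))) back nbr)))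
      periodic-state : ∀ i → state v (t + suc i) ≡ state v (suc i)
      periodic-state zero = trans (cong (state v) (+-comm t 1)) around
      periodic-state (suc i) = trans (cong (state v) (+-suc t (suc i))) (cong advance (periodic-state i))
      periodic-position : ∀ i → ω (t + i) ≡ ω i
      periodic-position zero = trans (cong ω (+-identityʳ t)) back
      periodic-position (suc i) = cong proj₂ (periodic-state i)
      D-periodic : ∀ i → D (t + i) ≡ D i
      D-periodic i = cong₂ (arc G) (periodic-position i) (trans (cong ω (sym (+-suc t i))) (periodic-position (suc i)))
      all-moves : ∀ i → Moves v i
      all-moves = <-rec (Moves v) moves-from-earlier
        where
        moves-from-earlier : ∀ i → (∀ {j} → j < i → Moves v j) → Moves v i
        moves-from-earlier i earlier with <-cmp i t
        ... | tri< i<t _ _ = ms i i<t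
        ... | tri≈ _ refl _ = moves-t
        ... | tri> _ _ t<i with m≤n⇒∃[o]m+o≡n t<i
        ...   | k , refl = moving (subst (λ st → Continuation (proj₁ st) (proj₂ st)) (sym (trans (cong (state v) (sym (+-suc t k))) (periodic-state k)))
                                    (Moves.continuation (earlier {suc k} (s≤s (+-monoˡ-≤ k (s≤s z≤n))))))
      p-alternating = noForbiddenPath⇒parityAlternating noP (walk-oriented {v} {2 + (t + t)} (λ i _ → all-moves i))
      p = proj₁ p-alternating
      alternating = proj₂ p-alternating
      k = proj₁ (cycle-length 3≤t D-periodic alternating)
      t≡4k = proj₁ (proj₂ (cycle-length 3≤t D-periodic alternating))
      1≤k = proj₂ (proj₂ (cycle-length 3≤t D-periodic alternating))
      closed : ∀ {i y} → i < t → Nbr G (ω i) y → ∃[ j ] (j < t × ω j ≡ y × (CycleStep t i j ⊎ CycleStep t j i))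
      closed {zero} {y} _ ny with exhaust first last first≢last ny
      ... | inj₁ y≡ = 1 , s≤s (<⇒≤ 1<s) , sym y≡ , inj₁ (step (s≤s (<⇒≤ 1<s)))
      ... | inj₂ y≡ = s , ≤-refl , sym y≡ , inj₂ (close refl)
      closed {suc i} {y} 1+i<t ny with exhaust
               (nbr-sym G (step-nbr (ms i (<-trans (n<1+n i) 1+i<t)))) (step-nbr (ms (suc i) 1+i<t))
               (≢-sym (no-return (ms i (<-trans (n<1+n i) 1+i<t)) (ms (suc i) 1+i<t))) ny
      ... | inj₁ y≡ = i , <-trans (n<1+n i) 1+i<t , sym y≡ , inj₂ (step 1+i<t)
      ... | inj₂ y≡ with m≤n⇒m<n∨m≡n 1+i<t
      ...   | inj₁ 2+i<t = 2 + i , 2+i<t , sym y≡ , inj₁ (step 2+i<t)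
      ...   | inj₂ 2+i≡t = 0 , s≤s z≤n , trans (sym back) (trans (cong ω (sym 2+i≡t)) (sym y≡)) , inj₁ (close 2+i≡t)

      component : ∃[ k ] ∃[ ds ] (1 ≤ k × length ds ≡ 4 * k × (∃[ M ] AltMatchingCycle ds M) × ComponentIs G v (cycleG ds))
      component = k , applyUpTo D t , 1≤k , trans len t≡4k , (parityClass p , cycle-altMatching 3≤t D-periodic alternating)
        , cycle-chart (s≤s z≤n) back (λ a<t b<t → injective (≤-pred a<t) (≤-pred b<t)) closed here

  cond2⇒cond3 : Cond3 G
  cond2⇒cond3 v with trail v
  ... | cycle (suc s) 3≤t back ms away = inj₂ (inj₂ (OnCycle.component v s 3≤t back ms away))
  ... | path t ¬m ms _ = inj₂ (inj₁ (path-component v t ¬m ms))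

theorem5p1 : (G : Digraph) → IrreflexiveOriented G →
    (Cond1 G ⇔ Cond2 G) × (Cond2 G ⇔ Cond3 G)
theorem5p1 G io = mk⇔ (cond1⇒cond2 {G}) (cond3⇒cond1 {G} ∘ cond2⇒cond3 io)
                , mk⇔ (cond2⇒cond3 io) (cond3⇒cond2 {G})
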